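{- Let $f\in x\mathbb{F}_p[x]$ and $k\ge1$. Then $$\overline{\omega}_x^k(f)-\sum_{b}c_b^{*}(f)\,\overline{w}_b\in\overline{M}_{k-1},$$ where the sum runs over all $p$-primary IF-data $b$ of depth exactly $k$ (only finitely many terms are nonzero), and $c_b^{*}(f)=\prod_{i=1}^k c^{*}_{b(i)}(f)$.
   Context: Let $p$ be a prime, $q=p^e$, and fix $\zeta\in\mathbb{F}_q$ such that $\zeta,\zeta^p,\dots,\zeta^{p^{e-1}}$ is an $\mathbb{F}_p$-basis of $\mathbb{F}_q$; identify $\zeta$ with its Teichmüller lift in $\mathbb{Z}_q=W(\mathbb{F}_q)$. Put $x_j^i=\zeta^{p^j}x^i$ and $X=\{x_j^i:1\le j\le e,\ i\ge1,\ p\nmid i\}$. Let $\sigma$ act on $\mathbb{Z}_q((x))$ by $\sum a_nx^n\mapsto\sum\mathrm{Frob}(a_n)x^{pn}$ (Witt-vector Frobenius on coefficients), and for $g\in x\mathbb{Z}_q[[x]]$ let $\tau(g)=\sum_{n\ge0}\sigma^n(g)$. A $p$-primary IF-datum of depth $k\ge0$ is a function $b:\{1,\dots,k\}\to X$; $b^{tr}$ is its restriction to $\{1,\dots,k-1\}$; set $w_b=1$ for depth $0$ and $w_b=\tau(b(k)w_{b^{tr}})$ otherwise, and let $\overline{w}_b\in\mathbb{F}_q[[x]]$ be its reduction mod $p$. Let $\overline{M}_k\subset\mathbb{F}_q((x))$ be the $\mathbb{F}_q(x)$-span of the $\overline{w}_b$ for $p$-primary IF-data of depth at most $k$. Define $\omega_x^0=1$,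 $\omega_x^k=\tau(x\,\omega_x^{k-1})\in\mathbb{Z}_p[[x]]$, let $\overline{\omega}_x^k\in\mathbb{F}_p[[x]]$ be its reduction mod $p$, and let $\overline{\omega}_x^k(f)$ denote the series obtained by substituting $f$ for $x$. For $f=\sum_i c_ix^i$, let $c_i^{*}(f)=\sum_{m\ge0}c_{ip^m}^{1/p^m}$; for $p\nmid i$ write $c_i^{*}(f)=\sum_{j=1}^{e}c^{*}_{x_j^i}(f)\,\zeta^{p^j}$ with $c^{*}_{x_j^i}(f)\in\mathbb{F}_p$ (using that $\zeta^{p^e}=\zeta$), which defines $c^{*}_z(f)\in\mathbb{F}_p$ for every $z\in X$. -}

module Defs where

open import Level using (_⊔_)
open import Algebra.Bundles using (CommutativeRing)
open import Data.Nat as ℕ using (ℕ; zero; suc; _≤_)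
open import Data.Nat.Properties using ()
open import Data.Nat.Divisibility using (_∣_; _∣?_; quotient)
open import Data.Nat.Primality using (Prime)
open import Data.Fin as Fin using (Fin; toℕ; fromℕ; inject₁)
open import Data.List as List using (List; []; _∷_; concatMap; upTo; allFin; length)
open import Data.List.Relation.Unary.Any using (Any)
open import Data.Product using (Σ; ∃; _×_; _,_)
open import Relation.Nullary using (¬_; yes; no)
open import Function using (_∘_)
open import Relation.Binary.PropositionalEquality using (_≡_)

record IsField {c ℓ} (R : CommutativeRing c ℓ) : Set (c ⊔ ℓ) where
  open CommutativeRing R
  field
    1≉0 : ¬ (1# ≈ 0#)
    inverse : ∀ a → ¬ (a ≈ 0#) → ∃ λ b → (a * b) ≈ 1#

module Setup {c ℓ} (R : CommutativeRing c ℓ) (p e : ℕ) (ζ : CommutativeRing.Carrier R) where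
  open CommutativeRing R

  _^ᴿ_ : Carrier → ℕ → Carrier
  a ^ᴿ zero  = 1#
  a ^ᴿ suc n = a * (a ^ᴿ n)

  fromℕᴿ : ℕ → Carrier
  fromℕᴿ zero    = 0#
  fromℕᴿ (suc n) = 1# + fromℕᴿ n

  -- F_p = Fin p, embedded in R
  ι : Fin p → Carrier
  ι a = fromℕᴿ (toℕ a)

  HasChar : Set ℓ
  HasChar = fromℕᴿ p ≈ 0#

  sumTo : ℕ → (ℕ → Carrier) → Carrier
  sumTo zero    f = 0#
  sumTo (suc n) f = sumTo n f + f n

  prodFin : ∀ k → (Fin k → Carrier) → Carrier
  prodFin zero    g = 1#
  prodFin (suc k) g = g Fin.zero * prodFin k (g ∘ Fin.suc)

  -- ζ^{p^j} for j ∈ {1,…,e}, with j represented by Fin e (j = toℕ j' + 1)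
  ζpow : Fin e → Carrier
  ζpow j = ζ ^ᴿ (p ℕ.^ suc (toℕ j))

  combine : (Fin e → Fin p) → Carrier
  combine a = sumTo e (λ n → go n)
    where
    go : ℕ → Carrier
    go n with n ℕ.<? e
    ... | yes n<e = ι (a (Fin.fromℕ< n<e)) * ζpow (Fin.fromℕ< n<e)
    ... | no  _   = 0#

  -- ζ, ζ^p, …, ζ^{p^{e-1}} (equivalently ζ^p,…,ζ^{p^e}) is an F_p-basis of R:
  -- given by the (necessarily unique) coordinate map.
  record NormalBasis : Set (c ⊔ ℓ) where
    field
      coord      : Carrier → Fin e → Fin p
      coord-cong : ∀ {y y'} → y ≈ y' → ∀ j → coord y j ≡ coord y' j
      combine-coord : ∀ y → combine (coord y) ≈ y
      coord-combine : ∀ a j → coord (combine a) j ≡ a j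

  Series : Set c
  Series = ℕ → Carrier

  _≈ₛ_ : Series → Series → Set ℓ
  S ≈ₛ T = ∀ N → S N ≈ T N

  0ₛ : Series
  0ₛ _ = 0#

  1ₛ : Series
  1ₛ zero    = 1#
  1ₛ (suc _) = 0#

  monomial : Carrier → ℕ → Series
  monomial a i N with N ℕ.≟ i
  ... | yes _ = a
  ... | no  _ = 0#

  _+ₛ_ : Series → Series → Series
  (S +ₛ T) N = S N + T N

  _-ₛ_ : Series → Series → Series
  (S -ₛ T) N = S N - T N

  _·ₛ_ : Carrier → Series → Series
  (a ·ₛ S) N = a * S N

  _⊛_ : Series → Series → Series
  (S ⊛ T) N = sumTo (suc N) (λ i → S i * T (N ℕ.∸ i))

  _^ₛ_ : Series → ℕ → Series
  S ^ₛ zero  = 1ₛ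
  S ^ₛ suc n = S ⊛ (S ^ₛ n)

  -- substitution h(g) for g with zero constant term:
  -- coefficient N is Σ_{n ≤ N} h_n (g^n)_N
  subst : Series → Series → Series
  subst h g N = sumTo (suc N) (λ n → h n * (g ^ₛ n) N)

  σ̄ : Series → Series
  σ̄ g N with p ∣? N
  ... | yes p∣N = g (quotient p∣N) ^ᴿ p
  ... | no  _   = 0#

  iter : ℕ → (Series → Series) → Series → Series
  iter zero    F g = g
  iter (suc n) F g = F (iter n F g)

  -- τ reduced mod p:  Σ_{n ≥ 0} σ̄^n(g), for g ∈ x R[[x]].
  -- (For g(0) = 0 the coefficient of x^N only receives contributions
  -- from n ≤ N, so the truncation is exact.)
  τ̄ : Series → Series
  τ̄ g N = sumTo (suc N) (λ n → iter n σ̄ g N)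

  record Xel : Set where
    constructor mkX
    field
      i   : ℕ
      j   : Fin e
      1≤i : 1 ≤ i
      p∤i : ¬ (p ∣ i)

  xSeries : Xel → Series
  xSeries z = monomial (ζpow (Xel.j z)) (Xel.i z)

  IFDatum : ℕ → Set
  IFDatum k = Fin k → Xel

  -- w̄_b  (b(k) = b (fromℕ k'), b^tr = b ∘ inject₁ for k = k'+1)
  w̄ : ∀ k → IFDatum k → Series
  w̄ zero    b = 1ₛ
  w̄ (suc k) b = τ̄ (xSeries (b (fromℕ k)) ⊛ w̄ k (b ∘ inject₁))

  ω̄ : ℕ → Series
  ω̄ zero    = 1ₛ
  ω̄ (suc k) = τ̄ (monomial 1# 1 ⊛ ω̄ k)

  -- Polynomials (coefficient lists, constant term first) as series.

  polySeries : List Carrier → Series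
  polySeries []       N       = 0#
  polySeries (a ∷ as) zero    = a
  polySeries (a ∷ as) (suc N) = polySeries as N

  NonZeroPoly : List Carrier → Set (c ⊔ ℓ)
  NonZeroPoly D = Any (λ a → ¬ (a ≈ 0#)) D

  record SpanTerm (m : ℕ) : Set c where
    constructor term
    field
      depth  : ℕ
      depth≤ : depth ≤ m
      datum  : IFDatum depth
      coeff  : List Carrier

  sumTerms : ∀ {m} → List (SpanTerm m) → Series
  sumTerms []                    = 0ₛ
  sumTerms (term d _ b P ∷ ts)   = (polySeries P ⊛ w̄ d b) +ₛ sumTerms ts

  -- T ∈ M̄_m : T lies in the R(x)-span of the w̄_b, depth b ≤ m.
  -- Clearing denominators: T = Σ (P_b / D) w̄_b in R((x))  with D ≠ 0,
  -- i.e.  D·T = Σ P_b w̄_b.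
  InM̄ : ℕ → Series → Set (c ⊔ ℓ)
  InM̄ m T = Σ (List Carrier) λ D → NonZeroPoly D ×
              Σ (List (SpanTerm m)) λ ts → (polySeries D ⊛ T) ≈ₛ sumTerms ts

  -- f ∈ x F_p[x], given by its coefficient list [c_1, c_2, …, c_d].

  coefFp : List (Fin p) → ℕ → Carrier
  coefFp []       _       = 0#
  coefFp (a ∷ as) zero    = ι a
  coefFp (a ∷ as) (suc n) = coefFp as n

  fSeries : List (Fin p) → Series
  fSeries f zero    = 0#
  fSeries f (suc n) = coefFp f n

  -- c_i^*(f) = Σ_{m ≥ 0} c_{i p^m}^{1/p^m} = Σ_{m ≥ 0} c_{i p^m}
  -- (coefficients lie in F_p, fixed by Frobenius; terms with m > deg f vanish)
  cstar : List (Fin p) → ℕ → Carrier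
  cstar f i = sumTo (suc (length f)) (λ m → fSeries f (i ℕ.* (p ℕ.^ m)))

  module WithBasis (NB : NormalBasis) where
    open NormalBasis NB

    cstarX : List (Fin p) → Xel → Fin p
    cstarX f z = coord (cstar f (Xel.i z)) (Xel.j z)

    cstarB : List (Fin p) → ∀ k → IFDatum k → Carrier
    cstarB f k b = prodFin k (λ t → ι (cstarX f (b t)))

    Xupto : ℕ → List Xel
    Xupto d = concatMap row (upTo d)
      where
      row : ℕ → List Xel
      row i' with p ∣? suc i'
      ... | yes _  = []
      ... | no p∤i = List.map (λ j → mkX (suc i') j (ℕ.s≤s ℕ.z≤n) p∤i) (allFin e)

    snoc : ∀ {k} → IFDatum k → Xel → IFDatum (suc k)
    snoc {zero}  b z Fin.zero    = z
    snoc {suc k} b z Fin.zero    = b Fin.zero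
    snoc {suc k} b z (Fin.suc t) = snoc (b ∘ Fin.suc) z t

    dataUpto : ℕ → ∀ k → List (IFDatum k)
    dataUpto d zero    = (λ ()) ∷ []
    dataUpto d (suc k) = concatMap (λ b → List.map (snoc b) (Xupto d)) (dataUpto d k)

    sumSeries : List Series → Series
    sumSeries []       = 0ₛ
    sumSeries (S ∷ Ss) = S +ₛ sumSeries Ss

    -- Σ_{b of depth k} c^*_b(f) w̄_b.  All nonzero terms have every
    -- index i ≤ deg f ≤ length f (since c_i^*(f) = 0 for i > deg f).
    mainSum : List (Fin p) → ℕ → Series
    mainSum f k = sumSeries (List.map (λ b → cstarB f k b ·ₛ w̄ k b)
                                      (dataUpto (length f) k))

{-# OPTIONS --safe #-}
module Submission where

open import Defs
open import Algebra.Bundles using (CommutativeRing)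
open import Data.Nat using (ℕ; _≤_; pred)
open import Data.Nat.Primality using (Prime)
open import Data.Fin using (Fin)
open import Data.List using (List)
open import Data.Nat using (suc)

-- Substituting f commutes with τ̄ because σ̄ f = f^p, so Ω_k = ω̄^k(f) satisfies Ω_(k+1) = τ̄ (f Ω_k).
-- Work modulo the F_q[x]-span of the w̄_b of depth < k.  It is stable under σ̄, as
-- σ̄ w̄_b = w̄_b − x_(b(k)) w̄_(b^tr); hence σ̄^m w̄_b ≡ w̄_b modulo lower depth, and since
-- τ̄ g = g + τ̄ (σ̄ g), a term c x^(i p^m) w̄_b may be replaced under τ̄ by c^(1/p^m) x^i w̄_b.
-- For p ∤ i, expanding c in the normal basis turns τ̄ (c x^i w̄_b) into a combination of the
-- w̄_(b, x_j^i).  So τ̄ (x · span_(<n)) ⊆ span_(<n+1), which controls the error terms, while in the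
-- main term the coefficients c_(i p^m) of f collect at x^i into c_i^*(f) = Σ_j c^*_(x_j^i)(f) ζ^(p^j).

module Arithmetic where
  open import Data.Nat
  open import Data.Nat.Properties
  open import Data.Nat.Combinatorics using (_C_; nCk+nC[k+1]≡[n+1]C[k+1]; nC1≡n)
  open import Data.Nat.Combinatorics.Specification using (k>n⇒nCk≡0)
  open import Data.Nat.Divisibility using (_∣_; _∣?_; _∣0; divides; quotient-<; ∣⇒≤)
  open import Data.Nat.Induction using (<-rec)
  open import Data.Nat.Primality using (Prime; euclidsLemma)
  open import Data.Nat.Solver using (module +-*-Solver)
  open import Data.Product using (_×_; _,_; map; map₂)
  open import Data.Sum using (inj₁; inj₂)
  open import Data.Empty using (⊥-elim)
  open import Relation.Nullary using (¬_; yes; no)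
  open import Relation.Binary.PropositionalEquality
  open ≡-Reasoning

  [k+1]*[n+1]C[k+1]≡[n+1]*nCk : ∀ n k → suc k * (suc n C suc k) ≡ suc n * (n C k)
  [k+1]*[n+1]C[k+1]≡[n+1]*nCk zero zero = refl
  [k+1]*[n+1]C[k+1]≡[n+1]*nCk zero (suc k)
    rewrite k>n⇒nCk≡0 {1} {suc (suc k)} (s≤s (s≤s z≤n)) | k>n⇒nCk≡0 {0} {suc k} (s≤s z≤n)
    = *-zeroʳ (suc (suc k))
  [k+1]*[n+1]C[k+1]≡[n+1]*nCk (suc n) zero
    rewrite nC1≡n (suc (suc n)) = cong (λ t → suc (suc t)) (trans (+-identityʳ n) (sym (*-identityʳ n)))
  [k+1]*[n+1]C[k+1]≡[n+1]*nCk (suc n) (suc k) = begin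
    suc (suc k) * (suc (suc n) C suc (suc k)) ≡⟨ cong (suc (suc k) *_) (nCk+nC[k+1]≡[n+1]C[k+1] (suc n) (suc k)) ⟨
    suc (suc k) * (A + B)                     ≡⟨ solve 3 (λ k A B → (con 2 :+ k) :* (A :+ B) := (con 1 :+ k) :* A :+ A :+ (con 2 :+ k) :* B) refl k A B ⟩
    suc k * A + A + suc (suc k) * B           ≡⟨ cong₂ (λ x y → x + A + y) ([k+1]*[n+1]C[k+1]≡[n+1]*nCk n k) ([k+1]*[n+1]C[k+1]≡[n+1]*nCk n (suc k)) ⟩
    suc n * a + A + suc n * b                 ≡⟨ solve 4 (λ n a b A → (con 1 :+ n) :* a :+ A :+ (con 1 :+ n) :* b := (con 1 :+ n) :* (a :+ b) :+ A) refl n a b A ⟩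
    suc n * (a + b) + A                       ≡⟨ cong (λ x → suc n * x + A) (nCk+nC[k+1]≡[n+1]C[k+1] n k) ⟩
    suc n * A + A                             ≡⟨ +-comm (suc n * A) A ⟩
    suc (suc n) * A                           ∎
    where
    open +-*-Solver
    A = suc n C suc k
    B = suc n C suc (suc k)
    a = n C k
    b = n C suc k

  p∣pCk : ∀ {p k} → Prime p → 0 < k → k < p → p ∣ p C k
  p∣pCk {suc n} {suc k} pr _ k<p
    with euclidsLemma (suc k) (suc n C suc k) pr
           (divides (n C k) (trans ([k+1]*[n+1]C[k+1]≡[n+1]*nCk n k) (*-comm (suc n) (n C k))))
  ... | inj₁ p∣k = ⊥-elim (<⇒≱ k<p (∣⇒≤ p∣k))
  ... | inj₂ p∣C = p∣C

  ∤⇒>0 : ∀ {p i} → ¬ p ∣ i → 0 < i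
  ∤⇒>0 {p} {zero}  p∤0 = ⊥-elim (p∤0 (p ∣0))
  ∤⇒>0 {p} {suc i} _   = z<s

  record PowerSplit (p a : ℕ) : Set where
    field
      cofactor   : ℕ
      exponent   : ℕ
      p∤cofactor : ¬ p ∣ cofactor
      split      : a ≡ cofactor * p ^ exponent

  module _ {p : ℕ} .{{_ : NonTrivial p}} where

    private instance
      p≢0 : NonZero p
      p≢0 = nonTrivial⇒nonZero p

    powerSplit : ∀ a .{{_ : NonZero a}} → PowerSplit p a
    powerSplit = <-rec (λ a → .{{NonZero a}} → PowerSplit p a) step
      where
      step : ∀ a → (∀ {b} → b < a → .{{NonZero b}} → PowerSplit p b) → .{{NonZero a}} → PowerSplit p a
      step a rec with p ∣? a
      ... | no p∤a = record { cofactor = a ; exponent = 0 ; p∤cofactor = p∤a ; split = sym (*-identityʳ a) }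
      ... | yes p∣a@(divides zero a≡0) = ⊥-elim (≢-nonZero⁻¹ a a≡0)
      ... | yes p∣a@(divides q@(suc _) a≡q*p) = record
        { cofactor = cofactor ; exponent = suc exponent ; p∤cofactor = p∤cofactor
        ; split = begin
            a                             ≡⟨ a≡q*p ⟩
            q * p                         ≡⟨ cong (_* p) split ⟩
            cofactor * p ^ exponent * p   ≡⟨ *-assoc cofactor (p ^ exponent) p ⟩
            cofactor * (p ^ exponent * p) ≡⟨ cong (cofactor *_) (*-comm (p ^ exponent) p) ⟩
            cofactor * p ^ suc exponent   ∎ }
        where open PowerSplit (rec (quotient-< p∣a))

    powerSplit-unique : ∀ i m j n → ¬ p ∣ i → ¬ p ∣ j → i * p ^ m ≡ j * p ^ n → i ≡ j × m ≡ n
    powerSplit-unique i zero j zero _ _ eq = trans (sym (*-identityʳ i)) (trans eq (*-identityʳ j)) , refl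
    powerSplit-unique i zero j (suc n) p∤i _ eq = ⊥-elim (p∤i (divides (j * p ^ n) (begin
      i                 ≡⟨ *-identityʳ i ⟨
      i * 1             ≡⟨ eq ⟩
      j * (p * p ^ n)   ≡⟨ cong (j *_) (*-comm p (p ^ n)) ⟩
      j * (p ^ n * p)   ≡⟨ *-assoc j (p ^ n) p ⟨
      j * p ^ n * p     ∎)))
    powerSplit-unique i (suc m) j zero p∤i p∤j eq = map sym sym (powerSplit-unique j zero i (suc m) p∤j p∤i (sym eq))
    powerSplit-unique i (suc m) j (suc n) p∤i p∤j eq =
      map₂ (cong suc) (powerSplit-unique i m j n p∤i p∤j (*-cancelˡ-≡ _ _ p (begin
        p * (i * p ^ m) ≡⟨ x∙yz≈y∙xz p i (p ^ m) ⟩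
        i * (p * p ^ m) ≡⟨ eq ⟩
        j * (p * p ^ n) ≡⟨ x∙yz≈y∙xz j p (p ^ n) ⟩
        p * (j * p ^ n) ∎)))
      where open import Algebra.Properties.CommutativeSemigroup *-commutativeSemigroup using (x∙yz≈y∙xz)

    m<p^m : ∀ m → m < p ^ m
    m<p^m zero    = z<s
    m<p^m (suc m) = <-≤-trans (≤-<-trans (m<p^m m) p^m<p^m*p) (≤-reflexive (*-comm (p ^ m) p))
      where
      p^m<p^m*p : p ^ m < p ^ m * p
      p^m<p^m*p = m<m*n (p ^ m) p {{m^n≢0 p m}} (nonTrivial⇒n>1 p)

open Arithmetic

module RingFacts {c ℓ} (R : CommutativeRing c ℓ) (p e : ℕ) (ζ : CommutativeRing.Carrier R) where
  open CommutativeRing R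
  open Setup R p e ζ
  open import Data.Nat as ℕ using (zero; suc; z≤n; s≤s; _<_)
  import Data.Nat.Properties as ℕ
  open import Data.Product using (_,_)
  open import Function using (_∘_)
  open import Relation.Binary.PropositionalEquality as ≡ using (_≢_)
  open import Relation.Nullary using (yes; no)
  open import Relation.Binary.Reasoning.Setoid setoid
  open import Algebra.Properties.CommutativeSemigroup +-commutativeSemigroup using (interchange)
  open import Data.Nat.Combinatorics using (_C_)

  sumTo-cong : ∀ n {f g : ℕ → Carrier} → (∀ i → f i ≈ g i) → sumTo n f ≈ sumTo n g
  sumTo-cong zero    f≈g = refl
  sumTo-cong (suc n) f≈g = +-cong (sumTo-cong n f≈g) (f≈g n)

  sumTo-cong< : ∀ n {f g : ℕ → Carrier} → (∀ i → i < n → f i ≈ g i) → sumTo n f ≈ sumTo n g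
  sumTo-cong< zero    f≈g = refl
  sumTo-cong< (suc n) f≈g = +-cong (sumTo-cong< n (λ i i<n → f≈g i (ℕ.m<n⇒m<1+n i<n))) (f≈g n (ℕ.n<1+n n))

  sumTo-zero : ∀ n {f : ℕ → Carrier} → (∀ i → i < n → f i ≈ 0#) → sumTo n f ≈ 0#
  sumTo-zero n {f} f≈0 = trans (sumTo-cong< n f≈0) (sumTo-0# n)
    where
    sumTo-0# : ∀ n → sumTo n (λ _ → 0#) ≈ 0#
    sumTo-0# zero    = refl
    sumTo-0# (suc n) = trans (+-identityʳ _) (sumTo-0# n)

  sumTo-+ : ∀ n (f g : ℕ → Carrier) → sumTo n (λ i → f i + g i) ≈ sumTo n f + sumTo n g
  sumTo-+ zero    f g = sym (+-identityʳ 0#)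
  sumTo-+ (suc n) f g = trans (+-cong (sumTo-+ n f g) refl) (interchange _ _ _ _)

  *-sumTo : ∀ n a (f : ℕ → Carrier) → a * sumTo n f ≈ sumTo n (λ i → a * f i)
  *-sumTo zero    a f = zeroʳ a
  *-sumTo (suc n) a f = trans (distribˡ a _ _) (+-cong (*-sumTo n a f) refl)

  sumTo-* : ∀ n a (f : ℕ → Carrier) → sumTo n f * a ≈ sumTo n (λ i → f i * a)
  sumTo-* n a f = trans (*-comm _ a) (trans (*-sumTo n a f) (sumTo-cong n (λ i → *-comm a (f i))))

  sumTo-head : ∀ n (f : ℕ → Carrier) → sumTo (suc n) f ≈ f 0 + sumTo n (f ∘ suc)
  sumTo-head zero    f = trans (+-identityˡ (f 0)) (sym (+-identityʳ (f 0)))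
  sumTo-head (suc n) f = trans (+-cong (sumTo-head n f) refl) (+-assoc _ _ _)

  sumTo-split : ∀ m n (f : ℕ → Carrier) → sumTo (m ℕ.+ n) f ≈ sumTo m f + sumTo n (λ i → f (m ℕ.+ i))
  sumTo-split m zero f = trans (reflexive (≡.cong (λ k → sumTo k f) (ℕ.+-identityʳ m))) (sym (+-identityʳ _))
  sumTo-split m (suc n) f = begin
    sumTo (m ℕ.+ suc n) f                                    ≡⟨ ≡.cong (λ k → sumTo k f) (ℕ.+-suc m n) ⟩
    sumTo (m ℕ.+ n) f + f (m ℕ.+ n)                          ≈⟨ +-cong (sumTo-split m n f) refl ⟩
    (sumTo m f + sumTo n (λ i → f (m ℕ.+ i))) + f (m ℕ.+ n)  ≈⟨ +-assoc _ _ _ ⟩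
    sumTo m f + sumTo (suc n) (λ i → f (m ℕ.+ i))            ∎

  sumTo-pad : ∀ m n (f : ℕ → Carrier) → m ℕ.≤ n → (∀ i → m ℕ.≤ i → i < n → f i ≈ 0#) → sumTo m f ≈ sumTo n f
  sumTo-pad m n f m≤n f≈0 with ℕ.m≤n⇒∃[o]m+o≡n m≤n
  ... | k , ≡.refl = sym (begin
    sumTo (m ℕ.+ k) f                          ≈⟨ sumTo-split m k f ⟩
    sumTo m f + sumTo k (λ i → f (m ℕ.+ i))    ≈⟨ +-cong refl (sumTo-zero k (λ i i<k → f≈0 (m ℕ.+ i) (ℕ.m≤m+n m i) (ℕ.+-monoʳ-< m i<k))) ⟩
    sumTo m f + 0#                             ≈⟨ +-identityʳ _ ⟩
    sumTo m f                                  ∎)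

  sumTo-swap : ∀ m n (g : ℕ → ℕ → Carrier) → sumTo m (λ i → sumTo n (g i)) ≈ sumTo n (λ j → sumTo m (λ i → g i j))
  sumTo-swap zero    n g = sym (sumTo-zero n (λ _ _ → refl))
  sumTo-swap (suc m) n g = trans (+-cong (sumTo-swap m n g) refl) (sym (sumTo-+ n _ _))

  sumTo-single : ∀ n k (f : ℕ → Carrier) → k < n → (∀ i → i < n → i ≢ k → f i ≈ 0#) → sumTo n f ≈ f k
  sumTo-single (suc n) k f k<1+n f≈0 with k ℕ.≟ n
  ... | yes ≡.refl = trans (+-cong (sumTo-zero n (λ i i<n → f≈0 i (ℕ.m<n⇒m<1+n i<n) (ℕ.<⇒≢ i<n))) refl) (+-identityˡ _)
  ... | no k≢n = trans (+-cong (sumTo-single n k f (ℕ.≤∧≢⇒< (ℕ.≤-pred k<1+n) k≢n) (λ i i<n → f≈0 i (ℕ.m<n⇒m<1+n i<n)))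
                              (f≈0 n (ℕ.n<1+n n) (k≢n ∘ ≡.sym)))
                       (+-identityʳ _)

  sumTo-reverse : ∀ n (f : ℕ → Carrier) → sumTo n f ≈ sumTo n (λ i → f (n ℕ.∸ suc i))
  sumTo-reverse zero    f = refl
  sumTo-reverse (suc n) f = begin
    sumTo n f + f n                                 ≈⟨ +-comm _ _ ⟩
    f n + sumTo n f                                 ≈⟨ +-cong refl (sumTo-reverse n f) ⟩
    f n + sumTo n (λ i → f (n ℕ.∸ suc i))           ≈⟨ sumTo-head n (λ i → f (suc n ℕ.∸ suc i)) ⟨
    sumTo (suc n) (λ i → f (suc n ℕ.∸ suc i))       ∎

  sumTo-triangle : ∀ n (g : ℕ → ℕ → Carrier) →
    sumTo n (λ i → sumTo (suc i) (λ j → g j i)) ≈ sumTo n (λ j → sumTo (n ℕ.∸ j) (λ k → g j (j ℕ.+ k)))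
  sumTo-triangle zero    g = refl
  sumTo-triangle (suc n) g = begin
    sumTo n (λ i → sumTo (suc i) (λ j → g j i)) + (sumTo n (λ j → g j n) + g n n)
      ≈⟨ +-cong (sumTo-triangle n g) refl ⟩
    sumTo n (λ j → sumTo (n ℕ.∸ j) (λ k → g j (j ℕ.+ k))) + (sumTo n (λ j → g j n) + g n n)
      ≈⟨ +-assoc _ _ _ ⟨
    (sumTo n (λ j → sumTo (n ℕ.∸ j) (λ k → g j (j ℕ.+ k))) + sumTo n (λ j → g j n)) + g n n
      ≈⟨ +-cong (sym (sumTo-+ n _ _)) last ⟩
    sumTo n (λ j → sumTo (n ℕ.∸ j) (λ k → g j (j ℕ.+ k)) + g j n) + sumTo (suc n ℕ.∸ n) (λ k → g n (n ℕ.+ k))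
      ≈⟨ +-cong (sumTo-cong< n row) refl ⟩
    sumTo n (λ j → sumTo (suc n ℕ.∸ j) (λ k → g j (j ℕ.+ k))) + sumTo (suc n ℕ.∸ n) (λ k → g n (n ℕ.+ k)) ∎
    where
    last : g n n ≈ sumTo (suc n ℕ.∸ n) (λ k → g n (n ℕ.+ k))
    last rewrite ℕ.+-∸-assoc 1 (ℕ.≤-refl {n}) | ℕ.n∸n≡0 n | ℕ.+-identityʳ n = sym (+-identityˡ _)
    row : ∀ j → j < n → sumTo (n ℕ.∸ j) (λ k → g j (j ℕ.+ k)) + g j n ≈ sumTo (suc n ℕ.∸ j) (λ k → g j (j ℕ.+ k))
    row j j<n rewrite ℕ.+-∸-assoc 1 (ℕ.<⇒≤ j<n) = +-cong refl (reflexive (≡.cong (g j) (≡.sym (ℕ.m+[n∸m]≡n (ℕ.<⇒≤ j<n)))))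

  sumTo-multiples : ∀ q .{{_ : ℕ.NonZero q}} M (G : ℕ → Carrier) →
    (∀ m r → 0 < r → r < q → G (q ℕ.* m ℕ.+ r) ≈ 0#) → sumTo (q ℕ.* M) G ≈ sumTo M (λ m → G (q ℕ.* m))
  sumTo-multiples q zero G G≈0 rewrite ℕ.*-zeroʳ q = refl
  sumTo-multiples q@(suc q') (suc M) G G≈0 = begin
    sumTo (q ℕ.* suc M) G
      ≡⟨ ≡.cong (λ t → sumTo t G) (≡.trans (ℕ.*-suc q M) (ℕ.+-comm q (q ℕ.* M))) ⟩
    sumTo (q ℕ.* M ℕ.+ q) G
      ≈⟨ sumTo-split (q ℕ.* M) q G ⟩
    sumTo (q ℕ.* M) G + sumTo q (λ i → G (q ℕ.* M ℕ.+ i))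
      ≈⟨ +-cong (sumTo-multiples q M G G≈0) (sumTo-head q' _) ⟩
    sumTo M (λ m → G (q ℕ.* m)) + (G (q ℕ.* M ℕ.+ 0) + sumTo q' (λ i → G (q ℕ.* M ℕ.+ suc i)))
      ≈⟨ +-cong refl (+-cong (reflexive (≡.cong G (ℕ.+-identityʳ _))) (sumTo-zero q' (λ i i<q' → G≈0 M (suc i) (s≤s z≤n) (s≤s i<q')))) ⟩
    sumTo M (λ m → G (q ℕ.* m)) + (G (q ℕ.* M) + 0#)
      ≈⟨ +-cong refl (+-identityʳ _) ⟩
    sumTo (suc M) (λ m → G (q ℕ.* m)) ∎

  ^ᴿ-cong : ∀ {a b} n → a ≈ b → a ^ᴿ n ≈ b ^ᴿ n
  ^ᴿ-cong zero    a≈b = refl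
  ^ᴿ-cong (suc n) a≈b = *-cong a≈b (^ᴿ-cong n a≈b)

  ^ᴿ-+ : ∀ a m n → a ^ᴿ (m ℕ.+ n) ≈ a ^ᴿ m * a ^ᴿ n
  ^ᴿ-+ a zero    n = sym (*-identityˡ _)
  ^ᴿ-+ a (suc m) n = trans (*-cong refl (^ᴿ-+ a m n)) (sym (*-assoc _ _ _))

  *-^ᴿ : ∀ a b n → (a * b) ^ᴿ n ≈ a ^ᴿ n * b ^ᴿ n
  *-^ᴿ a b zero    = sym (*-identityˡ 1#)
  *-^ᴿ a b (suc n) = trans (*-cong refl (*-^ᴿ a b n)) (interchange* _ _ _ _)
    where open import Algebra.Properties.CommutativeSemigroup *-commutativeSemigroup renaming (interchange to interchange*)

  ^ᴿ-* : ∀ a m n → a ^ᴿ (m ℕ.* n) ≈ (a ^ᴿ m) ^ᴿ n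
  ^ᴿ-* a m zero rewrite ℕ.*-zeroʳ m = refl
  ^ᴿ-* a m (suc n) = begin
    a ^ᴿ (m ℕ.* suc n)        ≡⟨ ≡.cong (a ^ᴿ_) (ℕ.*-suc m n) ⟩
    a ^ᴿ (m ℕ.+ m ℕ.* n)      ≈⟨ ^ᴿ-+ a m (m ℕ.* n) ⟩
    a ^ᴿ m * a ^ᴿ (m ℕ.* n)   ≈⟨ *-cong refl (^ᴿ-* a m n) ⟩
    (a ^ᴿ m) ^ᴿ suc n         ∎

  0^ᴿ : ∀ n .{{_ : ℕ.NonZero n}} → 0# ^ᴿ n ≈ 0#
  0^ᴿ (suc n) = zeroˡ _

  1^ᴿ : ∀ n → 1# ^ᴿ n ≈ 1#
  1^ᴿ zero    = refl
  1^ᴿ (suc n) = trans (*-identityˡ _) (1^ᴿ n)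

  fromℕᴿ-+ : ∀ m n → fromℕᴿ (m ℕ.+ n) ≈ fromℕᴿ m + fromℕᴿ n
  fromℕᴿ-+ zero    n = sym (+-identityˡ _)
  fromℕᴿ-+ (suc m) n = trans (+-cong refl (fromℕᴿ-+ m n)) (sym (+-assoc _ _ _))

  fromℕᴿ-* : ∀ m n → fromℕᴿ (m ℕ.* n) ≈ fromℕᴿ m * fromℕᴿ n
  fromℕᴿ-* zero    n = sym (zeroˡ _)
  fromℕᴿ-* (suc m) n = begin
    fromℕᴿ (n ℕ.+ m ℕ.* n)                  ≈⟨ fromℕᴿ-+ n (m ℕ.* n) ⟩
    fromℕᴿ n + fromℕᴿ (m ℕ.* n)             ≈⟨ +-cong (sym (*-identityˡ _)) (fromℕᴿ-* m n) ⟩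
    1# * fromℕᴿ n + fromℕᴿ m * fromℕᴿ n     ≈⟨ distribʳ _ _ _ ⟨
    (1# + fromℕᴿ m) * fromℕᴿ n              ∎

  ^ᴿ-+-of-binomials≈0 : ∀ m .{{_ : ℕ.NonZero m}} → (∀ k → 0 < k → k < m → fromℕᴿ (m C k) ≈ 0#) →
                          ∀ x y → (x + y) ^ᴿ m ≈ x ^ᴿ m + y ^ᴿ m
  ^ᴿ-+-of-binomials≈0 (suc n) C≈0 x y = begin
    (x + y) ^ᴿ suc n                 ≈⟨ ^≈^ᴿ (x + y) (suc n) ⟨
    (x + y) ^ suc n                  ≈⟨ Binomial.theorem (suc n) x y ⟩
    sum T                            ≈⟨ +-cong refl (sum-last n (T ∘ Fin.suc) middle≈0) ⟩
    T Fin.zero + T (Fin.fromℕ (suc n)) ≈⟨ +-cong first last ⟩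
    y ^ᴿ suc n + x ^ᴿ suc n          ≈⟨ +-comm _ _ ⟩
    x ^ᴿ suc n + y ^ᴿ suc n          ∎
    where
    import Algebra.Properties.CommutativeSemiring.Binomial commutativeSemiring as Binomial
    open import Algebra.Properties.Semiring.Exp semiring using (_^_)
    open import Algebra.Properties.Semiring.Mult semiring using (_×_)
    open import Algebra.Properties.Monoid.Sum +-monoid using (sum)
    open import Data.Fin as Fin using (Fin; toℕ)
    open import Data.Fin.Properties using (toℕ-fromℕ)
    open import Data.Nat.Combinatorics using (nCn≡1)

    ^≈^ᴿ : ∀ a n → a ^ n ≈ a ^ᴿ n
    ^≈^ᴿ a zero    = refl
    ^≈^ᴿ a (suc n) = *-cong refl (^≈^ᴿ a n)

    ×≈fromℕᴿ* : ∀ n a → n × a ≈ fromℕᴿ n * a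
    ×≈fromℕᴿ* zero    a = sym (zeroˡ a)
    ×≈fromℕᴿ* (suc n) a = trans (+-cong (sym (*-identityˡ a)) (×≈fromℕᴿ* n a)) (sym (distribʳ a 1# (fromℕᴿ n)))

    sum-last : ∀ n (u : Fin (suc n) → Carrier) → (∀ i → toℕ i < n → u i ≈ 0#) → sum u ≈ u (Fin.fromℕ n)
    sum-last zero    u u≈0 = +-identityʳ _
    sum-last (suc n) u u≈0 = trans (+-cong (u≈0 Fin.zero (s≤s z≤n)) (sum-last n (u ∘ Fin.suc) (λ i i<n → u≈0 (Fin.suc i) (s≤s i<n))))
                                   (+-identityˡ _)

    T : Fin (suc (suc n)) → Carrier
    T k = (suc n C toℕ k) × ((x ^ toℕ k) * (y ^ (suc n ℕ.∸ toℕ k)))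

    middle≈0 : ∀ i → toℕ i < n → T (Fin.suc i) ≈ 0#
    middle≈0 i i<n = trans (×≈fromℕᴿ* (suc n C suc (toℕ i)) _) (trans (*-cong (C≈0 (suc (toℕ i)) (s≤s z≤n) (s≤s i<n)) refl) (zeroˡ _))

    first : T Fin.zero ≈ y ^ᴿ suc n
    first = trans (+-identityʳ _) (trans (*-identityˡ _) (^≈^ᴿ y (suc n)))

    last : T (Fin.fromℕ (suc n)) ≈ x ^ᴿ suc n
    last rewrite toℕ-fromℕ n | nCn≡1 (suc n) | ℕ.n∸n≡0 n = trans (+-identityʳ _) (trans (*-identityʳ _) (^≈^ᴿ x (suc n)))

  module Frobenius (pr : Prime p) (char : HasChar) where
    open import Data.Nat.Divisibility using (_∣_; divides)
    open import Data.Nat.Primality using (prime⇒nonTrivial)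

    instance
      p-nonTrivial : ℕ.NonTrivial p
      p-nonTrivial = prime⇒nonTrivial pr

      p-nonZero : ℕ.NonZero p
      p-nonZero = ℕ.nonTrivial⇒nonZero p

    fromℕᴿ-multiple : ∀ m → p ∣ m → fromℕᴿ m ≈ 0#
    fromℕᴿ-multiple m (divides q ≡.refl) = trans (fromℕᴿ-* q p) (trans (*-cong refl char) (zeroʳ _))

    frob-+ : ∀ x y → (x + y) ^ᴿ p ≈ x ^ᴿ p + y ^ᴿ p
    frob-+ = ^ᴿ-+-of-binomials≈0 p (λ k 0<k k<p → fromℕᴿ-multiple _ (p∣pCk pr 0<k k<p))

    frob-0 : 0# ^ᴿ p ≈ 0#
    frob-0 = 0^ᴿ p

    frob-1 : 1# ^ᴿ p ≈ 1#
    frob-1 = 1^ᴿ p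

    frob-* : ∀ x y → (x * y) ^ᴿ p ≈ x ^ᴿ p * y ^ᴿ p
    frob-* x y = *-^ᴿ x y p

    frob-cong : ∀ {x y} → x ≈ y → x ^ᴿ p ≈ y ^ᴿ p
    frob-cong = ^ᴿ-cong p

    frob-sumTo : ∀ n f → sumTo n f ^ᴿ p ≈ sumTo n (λ i → f i ^ᴿ p)
    frob-sumTo zero    f = frob-0
    frob-sumTo (suc n) f = trans (frob-+ _ _) (+-cong (frob-sumTo n f) refl)

    frob-fromℕᴿ : ∀ n → fromℕᴿ n ^ᴿ p ≈ fromℕᴿ n
    frob-fromℕᴿ zero    = frob-0
    frob-fromℕᴿ (suc n) = trans (frob-+ _ _) (+-cong frob-1 (frob-fromℕᴿ n))

    frob-ι : ∀ a → ι a ^ᴿ p ≈ ι a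
    frob-ι a = frob-fromℕᴿ (Data.Fin.toℕ a)
      where import Data.Fin

    frob^ : ℕ → Carrier → Carrier
    frob^ m x = x ^ᴿ (p ℕ.^ m)

    frob^-suc : ∀ m x → frob^ (suc m) x ≈ frob^ m (x ^ᴿ p)
    frob^-suc m x = ^ᴿ-* x p (p ℕ.^ m)

    frob^-fixed : ∀ m x → x ^ᴿ p ≈ x → frob^ m x ≈ x
    frob^-fixed zero    x x^p≈x = *-identityʳ x
    frob^-fixed (suc m) x x^p≈x = trans (frob^-suc m x) (trans (^ᴿ-cong (p ℕ.^ m) x^p≈x) (frob^-fixed m x x^p≈x))

module SeriesOver {c ℓ} (R : CommutativeRing c ℓ) (p e : ℕ) (ζ : CommutativeRing.Carrier R) where
  open CommutativeRing R
  open Setup R p e ζ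
  open RingFacts R p e ζ
  open import Data.Nat as ℕ using (zero; suc; z≤n; s≤s; _<_)
  import Data.Nat.Properties as ℕ
  open import Data.Nat.Divisibility
    using (_∣_; _∣?_; _∣0; divides; quotient; m∣n⇒n≡m*quotient; ∣m+n∣m⇒∣n; ∣m∣n⇒∣m+n; m∣m*n; ∣⇒≤)
  open import Data.Empty using (⊥-elim)
  open import Data.List as List using ([]; _∷_; _++_; length)
  import Data.List.Properties as Listₚ
  open import Level using (_⊔_)
  open import Data.Product using (Σ; _×_; _,_; proj₁; proj₂)
  open import Function using (_∘_; id)
  open import Relation.Binary.PropositionalEquality as ≡ using (_≡_; _≢_)
  open import Relation.Nullary using (¬_; yes; no)
  import Relation.Binary.Reasoning.Setoid as SetoidReasoning
  open import Algebra.Properties.Monoid.Sum +-monoid using (sum; sum-cong-≋; sum-replicate-zero)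
  open import Algebra.Properties.CommutativeSemigroup +-commutativeSemigroup using (interchange; x∙yz≈y∙xz)
  open import Algebra.Properties.AbelianGroup +-abelianGroup using (xyx⁻¹≈y)
  open import Algebra.Properties.Ring ring using (-‿distribˡ-*)
  open import Data.Fin as Fin using (fromℕ; inject₁; fromℕ<; toℕ)

  module ≈-Reasoning = SetoidReasoning setoid

  ≈ₛ-refl : ∀ {S} → S ≈ₛ S
  ≈ₛ-refl N = refl

  ≈ₛ-sym : ∀ {S T} → S ≈ₛ T → T ≈ₛ S
  ≈ₛ-sym S≈T N = sym (S≈T N)

  ≈ₛ-trans : ∀ {S T U} → S ≈ₛ T → T ≈ₛ U → S ≈ₛ U
  ≈ₛ-trans S≈T T≈U N = trans (S≈T N) (T≈U N)

  ≈ₛ-reflexive : ∀ {S T} → S ≡ T → S ≈ₛ T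
  ≈ₛ-reflexive ≡.refl = ≈ₛ-refl

  -ₛ_ : Series → Series
  (-ₛ S) N = - S N

  +ₛ-cong : ∀ {S S′ T T′} → S ≈ₛ S′ → T ≈ₛ T′ → (S +ₛ T) ≈ₛ (S′ +ₛ T′)
  +ₛ-cong S≈S′ T≈T′ N = +-cong (S≈S′ N) (T≈T′ N)

  ⊛-cong : ∀ {S S′ T T′} → S ≈ₛ S′ → T ≈ₛ T′ → (S ⊛ T) ≈ₛ (S′ ⊛ T′)
  ⊛-cong S≈S′ T≈T′ N = sumTo-cong (suc N) (λ i → *-cong (S≈S′ i) (T≈T′ (N ℕ.∸ i)))

  ⊛-congˡ : ∀ {S S′} T → S ≈ₛ S′ → (S ⊛ T) ≈ₛ (S′ ⊛ T)
  ⊛-congˡ T S≈S′ = ⊛-cong S≈S′ (≈ₛ-refl {T})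

  ⊛-congʳ : ∀ S {T T′} → T ≈ₛ T′ → (S ⊛ T) ≈ₛ (S ⊛ T′)
  ⊛-congʳ S T≈T′ = ⊛-cong (≈ₛ-refl {S}) T≈T′

  ⊛-comm : ∀ S T → (S ⊛ T) ≈ₛ (T ⊛ S)
  ⊛-comm S T N = begin
    sumTo (suc N) (λ i → S i * T (N ℕ.∸ i))                  ≈⟨ sumTo-reverse (suc N) (λ i → S i * T (N ℕ.∸ i)) ⟩
    sumTo (suc N) (λ i → S (N ℕ.∸ i) * T (N ℕ.∸ (N ℕ.∸ i)))  ≈⟨ sumTo-cong< (suc N) swap ⟩
    sumTo (suc N) (λ i → T i * S (N ℕ.∸ i))                  ∎
    where
    open ≈-Reasoning
    swap : ∀ i → i < suc N → S (N ℕ.∸ i) * T (N ℕ.∸ (N ℕ.∸ i)) ≈ T i * S (N ℕ.∸ i)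
    swap i i≤N = trans (*-comm _ _) (*-cong (reflexive (≡.cong T (ℕ.m∸[m∸n]≡n (ℕ.≤-pred i≤N)))) refl)

  ⊛-identityˡ : ∀ S → (1ₛ ⊛ S) ≈ₛ S
  ⊛-identityˡ S N = begin
    sumTo (suc N) (λ i → 1ₛ i * S (N ℕ.∸ i))          ≈⟨ sumTo-head N _ ⟩
    1# * S N + sumTo N (λ i → 0# * S (N ℕ.∸ suc i))   ≈⟨ +-cong (*-identityˡ _) (sumTo-zero N (λ i _ → zeroˡ _)) ⟩
    S N + 0#                                          ≈⟨ +-identityʳ _ ⟩
    S N                                               ∎
    where open ≈-Reasoning

  ⊛-distribˡ : ∀ S T U → (S ⊛ (T +ₛ U)) ≈ₛ ((S ⊛ T) +ₛ (S ⊛ U))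
  ⊛-distribˡ S T U N = trans (sumTo-cong (suc N) (λ i → distribˡ _ _ _)) (sumTo-+ (suc N) _ _)

  ⊛-assoc : ∀ S T U → ((S ⊛ T) ⊛ U) ≈ₛ (S ⊛ (T ⊛ U))
  ⊛-assoc S T U N = begin
    sumTo (suc N) (λ i → sumTo (suc i) (λ j → S j * T (i ℕ.∸ j)) * U (N ℕ.∸ i))
      ≈⟨ sumTo-cong (suc N) (λ i → sumTo-* (suc i) _ _) ⟩
    sumTo (suc N) (λ i → sumTo (suc i) (λ j → S j * T (i ℕ.∸ j) * U (N ℕ.∸ i)))
      ≈⟨ sumTo-triangle (suc N) (λ j i → S j * T (i ℕ.∸ j) * U (N ℕ.∸ i)) ⟩
    sumTo (suc N) (λ j → sumTo (suc N ℕ.∸ j) (λ k → S j * T ((j ℕ.+ k) ℕ.∸ j) * U (N ℕ.∸ (j ℕ.+ k))))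
      ≈⟨ sumTo-cong< (suc N) row ⟩
    sumTo (suc N) (λ j → S j * sumTo (suc (N ℕ.∸ j)) (λ k → T k * U ((N ℕ.∸ j) ℕ.∸ k))) ∎
    where
    open ≈-Reasoning
    row : ∀ j → j < suc N → sumTo (suc N ℕ.∸ j) (λ k → S j * T ((j ℕ.+ k) ℕ.∸ j) * U (N ℕ.∸ (j ℕ.+ k)))
                          ≈ S j * sumTo (suc (N ℕ.∸ j)) (λ k → T k * U ((N ℕ.∸ j) ℕ.∸ k))
    row j j≤N rewrite ℕ.+-∸-assoc 1 (ℕ.≤-pred j≤N) = begin
      sumTo (suc (N ℕ.∸ j)) (λ k → S j * T ((j ℕ.+ k) ℕ.∸ j) * U (N ℕ.∸ (j ℕ.+ k)))
        ≈⟨ sumTo-cong (suc (N ℕ.∸ j)) (λ k → trans (*-assoc _ _ _)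
             (*-cong refl (*-cong (reflexive (≡.cong T (ℕ.m+n∸m≡n j k))) (reflexive (≡.cong U (≡.sym (ℕ.∸-+-assoc N j k))))))) ⟩
      sumTo (suc (N ℕ.∸ j)) (λ k → S j * (T k * U ((N ℕ.∸ j) ℕ.∸ k)))
        ≈⟨ *-sumTo (suc (N ℕ.∸ j)) _ _ ⟨
      S j * sumTo (suc (N ℕ.∸ j)) (λ k → T k * U ((N ℕ.∸ j) ℕ.∸ k)) ∎

  Series-commutativeRing : CommutativeRing c ℓ
  Series-commutativeRing = record
    { Carrier = Series
    ; _≈_ = _≈ₛ_
    ; _+_ = _+ₛ_
    ; _*_ = _⊛_
    ; -_ = -ₛ_
    ; 0# = 0ₛ
    ; 1# = 1ₛ
    ; isCommutativeRing = record
      { isRing = record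
        { +-isAbelianGroup = record
          { isGroup = record
            { isMonoid = record
              { isSemigroup = record
                { isMagma = record
                  { isEquivalence = record { refl = ≈ₛ-refl ; sym = ≈ₛ-sym ; trans = ≈ₛ-trans }
                  ; ∙-cong = +ₛ-cong }
                ; assoc = λ S T U N → +-assoc (S N) (T N) (U N) }
              ; identity = (λ S N → +-identityˡ (S N)) , (λ S N → +-identityʳ (S N)) }
            ; inverse = (λ S N → -‿inverseˡ (S N)) , (λ S N → -‿inverseʳ (S N))
            ; ⁻¹-cong = λ S≈T N → -‿cong (S≈T N) }
          ; comm = λ S T N → +-comm (S N) (T N) }
        ; *-cong = ⊛-cong
        ; *-assoc = ⊛-assoc
        ; *-identity = ⊛-identityˡ , (λ S → ≈ₛ-trans (⊛-comm S 1ₛ) (⊛-identityˡ S))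
        ; distrib = ⊛-distribˡ , (λ S T U → ≈ₛ-trans (⊛-comm (T +ₛ U) S)
                                   (≈ₛ-trans (⊛-distribˡ S T U) (+ₛ-cong (⊛-comm S T) (⊛-comm S U))))
        }
      ; *-comm = ⊛-comm
      }
    }

  module ≈ₛ-Reasoning = SetoidReasoning (CommutativeRing.setoid Series-commutativeRing)

  monomial-same : ∀ a i → monomial a i i ≈ a
  monomial-same a i with i ℕ.≟ i
  ... | yes _  = refl
  ... | no i≢i = ⊥-elim (i≢i ≡.refl)

  monomial-≢ : ∀ a i N → N ≢ i → monomial a i N ≈ 0#
  monomial-≢ a i N N≢i with N ℕ.≟ i
  ... | yes N≡i = ⊥-elim (N≢i N≡i)
  ... | no _    = refl

  monomial-≡ : ∀ a i N → N ≡ i → monomial a i N ≈ a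
  monomial-≡ a i N ≡.refl = monomial-same a i

  monomial-cong : ∀ {a b} i → a ≈ b → monomial a i ≈ₛ monomial b i
  monomial-cong i a≈b N with N ℕ.≟ i
  ... | yes _ = a≈b
  ... | no _  = refl

  monomial-+ : ∀ a b i → monomial (a + b) i ≈ₛ (monomial a i +ₛ monomial b i)
  monomial-+ a b i N with N ℕ.≟ i
  ... | yes _ = refl
  ... | no _  = sym (+-identityʳ 0#)

  monomial-0# : ∀ i → monomial 0# i ≈ₛ 0ₛ
  monomial-0# i N with N ℕ.≟ i
  ... | yes _ = refl
  ... | no _  = refl

  monomial-* : ∀ a b i → monomial (a * b) i ≈ₛ (a ·ₛ monomial b i)
  monomial-* a b i N with N ℕ.≟ i
  ... | yes _ = refl
  ... | no _  = sym (zeroʳ a)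

  1ₛ≈monomial : 1ₛ ≈ₛ monomial 1# 0
  1ₛ≈monomial zero    = sym (monomial-same 1# 0)
  1ₛ≈monomial (suc N) = sym (monomial-≢ 1# 0 (suc N) (λ ()))

  monomial-⊛-≥ : ∀ a i S N → i ℕ.≤ N → (monomial a i ⊛ S) N ≈ a * S (N ℕ.∸ i)
  monomial-⊛-≥ a i S N i≤N =
    trans (sumTo-single (suc N) i _ (s≤s i≤N) (λ k _ k≢i → trans (*-cong (monomial-≢ a i k k≢i) refl) (zeroˡ _)))
          (*-cong (monomial-same a i) refl)

  monomial-⊛-< : ∀ a i S N → N < i → (monomial a i ⊛ S) N ≈ 0#
  monomial-⊛-< a i S N N<i = sumTo-zero (suc N) (λ k k≤N →
    trans (*-cong (monomial-≢ a i k (λ k≡i → ℕ.<⇒≱ N<i (≡.subst (ℕ._≤ N) k≡i (ℕ.≤-pred k≤N)))) refl) (zeroˡ _))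

  monomial-⊛-monomial : ∀ a i b j → (monomial a i ⊛ monomial b j) ≈ₛ monomial (a * b) (i ℕ.+ j)
  monomial-⊛-monomial a i b j N with i ℕ.≤? N
  ... | no i≰N = trans (monomial-⊛-< a i (monomial b j) N (ℕ.≰⇒> i≰N))
                       (sym (monomial-≢ (a * b) (i ℕ.+ j) N (λ N≡i+j → i≰N (≡.subst (i ℕ.≤_) (≡.sym N≡i+j) (ℕ.m≤m+n i j)))))
  ... | yes i≤N with (N ℕ.∸ i) ℕ.≟ j
  ...   | yes N-i≡j = trans (monomial-⊛-≥ a i (monomial b j) N i≤N)
                        (trans (*-cong refl (monomial-≡ b j _ N-i≡j))
                          (sym (monomial-≡ (a * b) (i ℕ.+ j) N (≡.trans (≡.sym (ℕ.m+[n∸m]≡n i≤N)) (≡.cong (i ℕ.+_) N-i≡j)))))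
  ...   | no N-i≢j = trans (monomial-⊛-≥ a i (monomial b j) N i≤N)
                       (trans (*-cong refl (monomial-≢ b j _ N-i≢j))
                         (trans (zeroʳ _) (sym (monomial-≢ (a * b) (i ℕ.+ j) N
                           (λ N≡i+j → N-i≢j (≡.trans (≡.cong (ℕ._∸ i) N≡i+j) (ℕ.m+n∸m≡n i j)))))))

  monomial-⊛-monomial-⊛ : ∀ a i b j S → (monomial a i ⊛ (monomial b j ⊛ S)) ≈ₛ (monomial (a * b) (i ℕ.+ j) ⊛ S)
  monomial-⊛-monomial-⊛ a i b j S =
    ≈ₛ-trans (≈ₛ-sym (⊛-assoc (monomial a i) (monomial b j) S)) (⊛-congˡ S (monomial-⊛-monomial a i b j))

  ⊛-zeroʳ : ∀ S → (S ⊛ 0ₛ) ≈ₛ 0ₛ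
  ⊛-zeroʳ S N = sumTo-zero (suc N) (λ _ _ → zeroʳ _)

  ⊛-zeroˡ : ∀ S → (0ₛ ⊛ S) ≈ₛ 0ₛ
  ⊛-zeroˡ S N = sumTo-zero (suc N) (λ _ _ → zeroˡ _)

  ·ₛ-cong : ∀ {a b S T} → a ≈ b → S ≈ₛ T → (a ·ₛ S) ≈ₛ (b ·ₛ T)
  ·ₛ-cong a≈b S≈T N = *-cong a≈b (S≈T N)

  ·ₛ-congʳ : ∀ a {S T} → S ≈ₛ T → (a ·ₛ S) ≈ₛ (a ·ₛ T)
  ·ₛ-congʳ a = ·ₛ-cong refl

  ·ₛ-⊛ : ∀ a S T → ((a ·ₛ S) ⊛ T) ≈ₛ (a ·ₛ (S ⊛ T))
  ·ₛ-⊛ a S T N = trans (sumTo-cong (suc N) (λ i → *-assoc _ _ _)) (sym (*-sumTo (suc N) a _))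

  ⊛-·ₛ : ∀ a S T → (S ⊛ (a ·ₛ T)) ≈ₛ (a ·ₛ (S ⊛ T))
  ⊛-·ₛ a S T = ≈ₛ-trans (⊛-comm S _) (≈ₛ-trans (·ₛ-⊛ a T S) (·ₛ-congʳ a (⊛-comm T S)))

  ·ₛ-+ₛ : ∀ a S T → (a ·ₛ (S +ₛ T)) ≈ₛ ((a ·ₛ S) +ₛ (a ·ₛ T))
  ·ₛ-+ₛ a S T N = distribˡ a _ _

  ·ₛ-·ₛ : ∀ a b S → (a ·ₛ (b ·ₛ S)) ≈ₛ ((a * b) ·ₛ S)
  ·ₛ-·ₛ a b S N = sym (*-assoc _ _ _)

  -ₛ≈-1·ₛ : ∀ S → (-ₛ S) ≈ₛ ((- 1#) ·ₛ S)
  -ₛ≈-1·ₛ S N = trans (-‿cong (sym (*-identityˡ _))) (-‿distribˡ-* 1# (S N))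

  x̂ : Series
  x̂ = monomial 1# 1

  x̂-⊛-monomial-⊛ : ∀ a k S → (x̂ ⊛ (monomial a k ⊛ S)) ≈ₛ (monomial a (suc k) ⊛ S)
  x̂-⊛-monomial-⊛ a k S = ≈ₛ-trans (monomial-⊛-monomial-⊛ 1# 1 a k S) (⊛-congˡ S (monomial-cong (suc k) (*-identityˡ a)))

  sumₛ : ℕ → (ℕ → Series) → Series
  sumₛ n F N = sumTo n (λ i → F i N)

  sumₛ-cong : ∀ n {F G} → (∀ i → F i ≈ₛ G i) → sumₛ n F ≈ₛ sumₛ n G
  sumₛ-cong n F≈G N = sumTo-cong n (λ i → F≈G i N)

  ⊛-sumₛ : ∀ n S F → (S ⊛ sumₛ n F) ≈ₛ sumₛ n (λ i → S ⊛ F i)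
  ⊛-sumₛ zero    S F = ⊛-zeroʳ S
  ⊛-sumₛ (suc n) S F = ≈ₛ-trans (⊛-distribˡ S (sumₛ n F) (F n)) (+ₛ-cong (⊛-sumₛ n S F) ≈ₛ-refl)

  sumₛ-⊛ : ∀ n S F → (sumₛ n F ⊛ S) ≈ₛ sumₛ n (λ i → F i ⊛ S)
  sumₛ-⊛ n S F = ≈ₛ-trans (⊛-comm _ S) (≈ₛ-trans (⊛-sumₛ n S F) (sumₛ-cong n (λ i → ⊛-comm S (F i))))

  OrderAtLeast : ℕ → Series → Set ℓ
  OrderAtLeast n S = ∀ N → N < n → S N ≈ 0#

  order≥0 : ∀ S → OrderAtLeast 0 S
  order≥0 S N ()

  order-≤ : ∀ {m n S} → m ℕ.≤ n → OrderAtLeast n S → OrderAtLeast m S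
  order-≤ m≤n ord N N<m = ord N (ℕ.<-≤-trans N<m m≤n)

  order-·ₛ : ∀ {n S} a → OrderAtLeast n S → OrderAtLeast n (a ·ₛ S)
  order-·ₛ a ord N N<n = trans (*-cong refl (ord N N<n)) (zeroʳ a)

  order-⊛ : ∀ {m n S T} → OrderAtLeast m S → OrderAtLeast n T → OrderAtLeast (m ℕ.+ n) (S ⊛ T)
  order-⊛ {m} {n} {S} {T} ordS ordT N N<m+n = sumTo-zero (suc N) term≈0
    where
    term≈0 : ∀ i → i < suc N → S i * T (N ℕ.∸ i) ≈ 0#
    term≈0 i i≤N with i ℕ.<? m
    ... | yes i<m = trans (*-cong (ordS i i<m) refl) (zeroˡ _)
    ... | no i≮m  = trans (*-cong refl (ordT (N ℕ.∸ i) N-i<n)) (zeroʳ _)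
      where
      N-i<n : N ℕ.∸ i < n
      N-i<n = ℕ.+-cancelˡ-< i (N ℕ.∸ i) n
                (ℕ.<-≤-trans (≡.subst (_< m ℕ.+ n) (≡.sym (ℕ.m+[n∸m]≡n (ℕ.≤-pred i≤N))) N<m+n) (ℕ.+-monoˡ-≤ n (ℕ.≮⇒≥ i≮m)))

  order-monomial : ∀ a i → OrderAtLeast i (monomial a i)
  order-monomial a i N N<i = monomial-≢ a i N (ℕ.<⇒≢ N<i)

  order-monomial-⊛ : ∀ a k S → OrderAtLeast k (monomial a k ⊛ S)
  order-monomial-⊛ a k S = order-≤ (ℕ.≤-reflexive (≡.sym (ℕ.+-identityʳ k))) (order-⊛ (order-monomial a k) (order≥0 S))

  order-^ₛ : ∀ {g} → OrderAtLeast 1 g → ∀ n → OrderAtLeast n (g ^ₛ n)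
  order-^ₛ ord zero    = order≥0 _
  order-^ₛ ord (suc n) = order-⊛ ord (order-^ₛ ord n)

  Summable : (ℕ → Series) → Set ℓ
  Summable F = ∀ n → OrderAtLeast n (F n)

  -- Only F 0, …, F N contribute to the coefficient of x^N.
  Σ∞ : (ℕ → Series) → Series
  Σ∞ F N = sumTo (suc N) (λ n → F n N)

  Σ∞-cong : ∀ {F G} → (∀ n → F n ≈ₛ G n) → Σ∞ F ≈ₛ Σ∞ G
  Σ∞-cong F≈G N = sumTo-cong (suc N) (λ n → F≈G n N)

  Σ∞-truncate : ∀ {F} → Summable F → ∀ N M → N < M → Σ∞ F N ≈ sumTo M (λ n → F n N)
  Σ∞-truncate sF N M N<M = sumTo-pad (suc N) M _ N<M (λ n N<n _ → sF n N N<n)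

  Σ∞-head : ∀ {F} → (∀ n → OrderAtLeast (suc n) (F (suc n))) → Σ∞ F ≈ₛ (F 0 +ₛ Σ∞ (F ∘ suc))
  Σ∞-head {F} sF N = trans (sumTo-head N _) (+-cong refl (trans (sym (+-identityʳ _)) (+-cong refl (sym (sF N N (ℕ.n<1+n N))))))

  ⊛-Σ∞ : ∀ {F} S → Summable F → (S ⊛ Σ∞ F) ≈ₛ Σ∞ (λ n → S ⊛ F n)
  ⊛-Σ∞ {F} S sF N = begin
    sumTo (suc N) (λ i → S i * Σ∞ F (N ℕ.∸ i))
      ≈⟨ sumTo-cong< (suc N) (λ i i≤N → *-cong refl (Σ∞-truncate sF (N ℕ.∸ i) (suc N) (s≤s (ℕ.m∸n≤m N i)))) ⟩
    sumTo (suc N) (λ i → S i * sumTo (suc N) (λ n → F n (N ℕ.∸ i)))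
      ≈⟨ sumTo-cong (suc N) (λ i → *-sumTo (suc N) (S i) _) ⟩
    sumTo (suc N) (λ i → sumTo (suc N) (λ n → S i * F n (N ℕ.∸ i)))
      ≈⟨ sumTo-swap (suc N) (suc N) _ ⟩
    sumTo (suc N) (λ n → (S ⊛ F n) N) ∎
    where open ≈-Reasoning

  subst-cong : ∀ {h h′} g → h ≈ₛ h′ → subst h g ≈ₛ subst h′ g
  subst-cong g h≈h′ N = sumTo-cong (suc N) (λ n → *-cong (h≈h′ n) refl)

  subst-+ₛ : ∀ h k g → subst (h +ₛ k) g ≈ₛ (subst h g +ₛ subst k g)
  subst-+ₛ h k g N = trans (sumTo-cong (suc N) (λ n → distribʳ _ _ _)) (sumTo-+ (suc N) _ _)

  subst-at-0 : ∀ h g → subst h g 0 ≈ h 0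
  subst-at-0 h g = trans (+-identityˡ _) (*-identityʳ _)

  subst-1ₛ : ∀ g → subst 1ₛ g ≈ₛ 1ₛ
  subst-1ₛ g N = trans (sumTo-head N _) (trans (+-cong (*-identityˡ _) (sumTo-zero N (λ n _ → zeroˡ _))) (+-identityʳ _))

  subst-summable : ∀ {g} → OrderAtLeast 1 g → ∀ (h : Series) → Summable (λ n → h n ·ₛ (g ^ₛ n))
  subst-summable ord h n = order-·ₛ (h n) (order-^ₛ ord n)

  subst-x̂⊛ : ∀ {g} → OrderAtLeast 1 g → ∀ h → subst (x̂ ⊛ h) g ≈ₛ (g ⊛ subst h g)
  subst-x̂⊛ {g} ord h = begin
    subst (x̂ ⊛ h) g
      ≈⟨ Σ∞-head {F = λ n → (x̂ ⊛ h) n ·ₛ (g ^ₛ n)} (λ n → order-·ₛ _ (order-^ₛ ord (suc n))) ⟩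
    ((x̂ ⊛ h) 0 ·ₛ 1ₛ) +ₛ Σ∞ (λ n → (x̂ ⊛ h) (suc n) ·ₛ (g ^ₛ suc n))
      ≈⟨ +ₛ-cong constant≈0 (Σ∞-cong shift) ⟩
    0ₛ +ₛ Σ∞ (λ n → h n ·ₛ (g ^ₛ suc n))
      ≈⟨ (λ N → +-identityˡ _) ⟩
    Σ∞ (λ n → h n ·ₛ (g ⊛ (g ^ₛ n)))
      ≈⟨ Σ∞-cong (λ n → ⊛-·ₛ (h n) g (g ^ₛ n)) ⟨
    Σ∞ (λ n → g ⊛ (h n ·ₛ (g ^ₛ n)))
      ≈⟨ ⊛-Σ∞ g (subst-summable ord h) ⟨
    g ⊛ subst h g ∎
    where
    open ≈ₛ-Reasoning
    constant≈0 : ((x̂ ⊛ h) 0 ·ₛ 1ₛ) ≈ₛ 0ₛ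
    constant≈0 N = trans (*-cong (monomial-⊛-< 1# 1 h 0 (s≤s z≤n)) refl) (zeroˡ _)
    shift : ∀ n → ((x̂ ⊛ h) (suc n) ·ₛ (g ^ₛ suc n)) ≈ₛ (h n ·ₛ (g ^ₛ suc n))
    shift n N = *-cong (trans (monomial-⊛-≥ 1# 1 h (suc n) (s≤s z≤n)) (*-identityˡ _)) refl

  fSeries-∷ : ∀ a as → fSeries (a ∷ as) ≈ₛ (monomial (ι a) 1 +ₛ (x̂ ⊛ fSeries as))
  fSeries-∷ a as zero          = sym (trans (+-cong (monomial-≢ (ι a) 1 0 (λ ())) (monomial-⊛-< 1# 1 (fSeries as) 0 (s≤s z≤n))) (+-identityʳ 0#))
  fSeries-∷ a as (suc zero)    = sym (trans (+-cong (monomial-same (ι a) 1) (trans (monomial-⊛-≥ 1# 1 (fSeries as) 1 (s≤s z≤n)) (zeroʳ _))) (+-identityʳ _))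
  fSeries-∷ a as (suc (suc m)) = sym (trans (+-cong (monomial-≢ (ι a) 1 (suc (suc m)) (λ ()))
                                     (trans (monomial-⊛-≥ 1# 1 (fSeries as) (suc (suc m)) (s≤s z≤n)) (*-identityˡ _))) (+-identityˡ _))

  order-fSeries : ∀ f → OrderAtLeast 1 (fSeries f)
  order-fSeries f zero _ = refl
  order-fSeries f (suc N) (s≤s ())

  coefFp-≥length : ∀ g n → length g ℕ.≤ n → coefFp g n ≈ 0#
  coefFp-≥length []      n       _          = refl
  coefFp-≥length (a ∷ g) (suc n) (s≤s g≤n) = coefFp-≥length g n g≤n

  module CharacteristicP (pr : Prime p) (char : HasChar) where
    open Frobenius pr char

    σ̄-p* : ∀ S m → σ̄ S (p ℕ.* m) ≈ S m ^ᴿ p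
    σ̄-p* S m with p ∣? (p ℕ.* m)
    ... | yes p∣pm = frob-cong (reflexive (≡.cong S (ℕ.*-cancelˡ-≡ _ m p (≡.sym (m∣n⇒n≡m*quotient p∣pm)))))
    ... | no p∤pm  = ⊥-elim (p∤pm (m∣m*n m))

    σ̄-at : ∀ S {N} m → N ≡ p ℕ.* m → σ̄ S N ≈ S m ^ᴿ p
    σ̄-at S m ≡.refl = σ̄-p* S m

    σ̄-∤ : ∀ S {N} → ¬ p ∣ N → σ̄ S N ≈ 0#
    σ̄-∤ S {N} p∤N with p ∣? N
    ... | yes p∣N = ⊥-elim (p∤N p∣N)
    ... | no _    = refl

    data MultipleView (N : ℕ) : Set where
      multiple    : ∀ m → N ≡ p ℕ.* m → MultipleView N
      nonmultiple : ¬ p ∣ N → MultipleView N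

    multipleView : ∀ N → MultipleView N
    multipleView N with p ∣? N
    ... | yes p∣N = multiple (quotient p∣N) (m∣n⇒n≡m*quotient p∣N)
    ... | no p∤N  = nonmultiple p∤N

    p∤p*m+r : ∀ m r → 0 < r → r < p → ¬ p ∣ (p ℕ.* m ℕ.+ r)
    p∤p*m+r m r 0<r r<p p∣ = ℕ.<⇒≱ r<p (∣⇒≤ ⦃ ℕ.>-nonZero 0<r ⦄ (∣m+n∣m⇒∣n p∣ (m∣m*n m)))

    σ̄-cong : ∀ {S T} → S ≈ₛ T → σ̄ S ≈ₛ σ̄ T
    σ̄-cong {S} {T} S≈T N with multipleView N
    ... | multiple m N≡pm = trans (σ̄-at S m N≡pm) (trans (frob-cong (S≈T m)) (sym (σ̄-at T m N≡pm)))
    ... | nonmultiple p∤N = trans (σ̄-∤ S p∤N) (sym (σ̄-∤ T p∤N))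

    σ̄-+ₛ : ∀ S T → σ̄ (S +ₛ T) ≈ₛ (σ̄ S +ₛ σ̄ T)
    σ̄-+ₛ S T N with multipleView N
    ... | multiple m N≡pm = trans (σ̄-at (S +ₛ T) m N≡pm) (trans (frob-+ _ _) (sym (+-cong (σ̄-at S m N≡pm) (σ̄-at T m N≡pm))))
    ... | nonmultiple p∤N = trans (σ̄-∤ _ p∤N) (sym (trans (+-cong (σ̄-∤ S p∤N) (σ̄-∤ T p∤N)) (+-identityʳ 0#)))

    σ̄-·ₛ : ∀ a S → σ̄ (a ·ₛ S) ≈ₛ ((a ^ᴿ p) ·ₛ σ̄ S)
    σ̄-·ₛ a S N with multipleView N
    ... | multiple m N≡pm = trans (σ̄-at (a ·ₛ S) m N≡pm) (trans (frob-* _ _) (*-cong refl (sym (σ̄-at S m N≡pm))))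
    ... | nonmultiple p∤N = trans (σ̄-∤ _ p∤N) (sym (trans (*-cong refl (σ̄-∤ S p∤N)) (zeroʳ _)))

    σ̄-0ₛ : σ̄ 0ₛ ≈ₛ 0ₛ
    σ̄-0ₛ N with multipleView N
    ... | multiple m N≡pm = trans (σ̄-at 0ₛ m N≡pm) frob-0
    ... | nonmultiple p∤N = σ̄-∤ _ p∤N

    σ̄-1ₛ : σ̄ 1ₛ ≈ₛ 1ₛ
    σ̄-1ₛ zero = trans (σ̄-at 1ₛ 0 (≡.sym (ℕ.*-zeroʳ p))) frob-1
    σ̄-1ₛ (suc N) with multipleView (suc N)
    ... | multiple zero    N+1≡0       = ⊥-elim (ℕ.1+n≢0 (≡.trans N+1≡0 (ℕ.*-zeroʳ p)))
    ... | multiple (suc m) N+1≡p[m+1] = trans (σ̄-at 1ₛ (suc m) N+1≡p[m+1]) frob-0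
    ... | nonmultiple p∤N+1          = σ̄-∤ 1ₛ p∤N+1

    σ̄-⊛ : ∀ S T → σ̄ (S ⊛ T) ≈ₛ (σ̄ S ⊛ σ̄ T)
    σ̄-⊛ S T N with multipleView N
    ... | multiple M ≡.refl = sym (begin
      sumTo (suc (p ℕ.* M)) G                       ≈⟨ sumTo-pad (suc (p ℕ.* M)) (p ℕ.* suc M) G pM<p[M+1] tail≈0 ⟩
      sumTo (p ℕ.* suc M) G                         ≈⟨ sumTo-multiples p (suc M) G (λ m r 0<r r<p → G-∤ (p∤p*m+r m r 0<r r<p)) ⟩
      sumTo (suc M) (λ m → G (p ℕ.* m))             ≈⟨ sumTo-cong< (suc M) G-p* ⟩
      sumTo (suc M) (λ m → (S m * T (M ℕ.∸ m)) ^ᴿ p) ≈⟨ frob-sumTo (suc M) _ ⟨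
      (S ⊛ T) M ^ᴿ p                                ≈⟨ σ̄-p* (S ⊛ T) M ⟨
      σ̄ (S ⊛ T) (p ℕ.* M)                           ∎)
      where
      open ≈-Reasoning
      G : ℕ → Carrier
      G i = σ̄ S i * σ̄ T (p ℕ.* M ℕ.∸ i)
      G-∤ : ∀ {i} → ¬ p ∣ i → G i ≈ 0#
      G-∤ p∤i = trans (*-cong (σ̄-∤ S p∤i) refl) (zeroˡ _)
      G-p* : ∀ m → m < suc M → G (p ℕ.* m) ≈ (S m * T (M ℕ.∸ m)) ^ᴿ p
      G-p* m _ = trans (*-cong (σ̄-p* S m) (σ̄-at T (M ℕ.∸ m) (≡.sym (ℕ.*-distribˡ-∸ p M m)))) (sym (frob-* _ _))
      pM<p[M+1] : suc (p ℕ.* M) ℕ.≤ p ℕ.* suc M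
      pM<p[M+1] = ℕ.≤-trans (ℕ.+-monoˡ-≤ (p ℕ.* M) (ℕ.>-nonZero⁻¹ p)) (ℕ.≤-reflexive (≡.sym (ℕ.*-suc p M)))
      tail≈0 : ∀ i → suc (p ℕ.* M) ℕ.≤ i → i < p ℕ.* suc M → G i ≈ 0#
      tail≈0 i pM<i i<p[M+1] = G-∤ (≡.subst (λ j → ¬ p ∣ j) i≡pM+r (p∤p*m+r M r (ℕ.m<n⇒0<n∸m pM<i) r<p))
        where
        r = i ℕ.∸ p ℕ.* M
        i≡pM+r : p ℕ.* M ℕ.+ r ≡ i
        i≡pM+r = ℕ.m+[n∸m]≡n (ℕ.<⇒≤ pM<i)
        r<p : r < p
        r<p = ℕ.+-cancelˡ-< (p ℕ.* M) r p
                (≡.subst₂ _<_ (≡.sym i≡pM+r) (≡.trans (ℕ.*-suc p M) (ℕ.+-comm p (p ℕ.* M))) i<p[M+1])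
    ... | nonmultiple p∤N = trans (σ̄-∤ _ p∤N) (sym (sumTo-zero (suc N) term≈0))
      where
      term≈0 : ∀ i → i < suc N → σ̄ S i * σ̄ T (N ℕ.∸ i) ≈ 0#
      term≈0 i i≤N with multipleView i
      ... | nonmultiple p∤i = trans (*-cong (σ̄-∤ S p∤i) refl) (zeroˡ _)
      ... | multiple a i≡pa = trans (*-cong refl (σ̄-∤ T p∤N-i)) (zeroʳ _)
        where
        p∤N-i : ¬ p ∣ (N ℕ.∸ i)
        p∤N-i p∣N-i = p∤N (≡.subst (p ∣_) (ℕ.m∸n+n≡m (ℕ.≤-pred i≤N)) (∣m∣n⇒∣m+n p∣N-i (divides a (≡.trans i≡pa (ℕ.*-comm p a)))))

    σ̄-monomial : ∀ a i → σ̄ (monomial a i) ≈ₛ monomial (a ^ᴿ p) (p ℕ.* i)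
    σ̄-monomial a i N with multipleView N
    ... | nonmultiple p∤N = trans (σ̄-∤ _ p∤N) (sym (monomial-≢ _ (p ℕ.* i) N (λ N≡pi → p∤N (divides i (≡.trans N≡pi (ℕ.*-comm p i))))))
    ... | multiple m ≡.refl with m ℕ.≟ i
    ...   | yes ≡.refl = trans (σ̄-p* _ m) (trans (frob-cong (monomial-same a m)) (sym (monomial-same (a ^ᴿ p) (p ℕ.* m))))
    ...   | no m≢i     = trans (σ̄-p* _ m) (trans (frob-cong (monomial-≢ a i m m≢i))
                           (trans frob-0 (sym (monomial-≢ (a ^ᴿ p) (p ℕ.* i) (p ℕ.* m) (m≢i ∘ ℕ.*-cancelˡ-≡ m i p)))))

    σ̄-sumₛ : ∀ n F → σ̄ (sumₛ n F) ≈ₛ sumₛ n (λ i → σ̄ (F i))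
    σ̄-sumₛ zero    F = σ̄-0ₛ
    σ̄-sumₛ (suc n) F = ≈ₛ-trans (σ̄-+ₛ (sumₛ n F) (F n)) (+ₛ-cong (σ̄-sumₛ n F) ≈ₛ-refl)

    p*m<N⇒m<N : ∀ {m N} → N ≡ p ℕ.* m → 0 < N → m < N
    p*m<N⇒m<N {zero}  _      0<N = 0<N
    p*m<N⇒m<N {suc m} ≡.refl _   = ≡.subst (suc m <_) (ℕ.*-comm (suc m) p) (ℕ.m<m*n (suc m) p (ℕ.nonTrivial⇒n>1 p))

    order-σ̄ : ∀ {k S} → OrderAtLeast (suc k) S → OrderAtLeast (suc (suc k)) (σ̄ S)
    order-σ̄ {k} {S} ord zero _ = trans (σ̄-at S 0 (≡.sym (ℕ.*-zeroʳ p))) (trans (frob-cong (ord 0 (s≤s z≤n))) frob-0)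
    order-σ̄ {k} {S} ord (suc N) N+1<k+2 with multipleView (suc N)
    ... | nonmultiple p∤N+1 = σ̄-∤ S p∤N+1
    ... | multiple m N+1≡pm = trans (σ̄-at S m N+1≡pm) (trans (frob-cong (ord m m<k+1)) frob-0)
      where
      m<k+1 : m < suc k
      m<k+1 = ℕ.<-≤-trans (p*m<N⇒m<N N+1≡pm (s≤s z≤n)) (ℕ.≤-pred N+1<k+2)

    iter-σ̄-cong : ∀ n {S T} → S ≈ₛ T → iter n σ̄ S ≈ₛ iter n σ̄ T
    iter-σ̄-cong zero    S≈T = S≈T
    iter-σ̄-cong (suc n) S≈T = σ̄-cong (iter-σ̄-cong n S≈T)

    iter-σ̄-comm : ∀ n S → iter n σ̄ (σ̄ S) ≡ σ̄ (iter n σ̄ S)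
    iter-σ̄-comm zero    S = ≡.refl
    iter-σ̄-comm (suc n) S = ≡.cong σ̄ (iter-σ̄-comm n S)

    iter-σ̄-+ₛ : ∀ n S T → iter n σ̄ (S +ₛ T) ≈ₛ (iter n σ̄ S +ₛ iter n σ̄ T)
    iter-σ̄-+ₛ zero    S T = ≈ₛ-refl
    iter-σ̄-+ₛ (suc n) S T = ≈ₛ-trans (σ̄-cong (iter-σ̄-+ₛ n S T)) (σ̄-+ₛ _ _)

    iter-σ̄-·ₛ : ∀ n {a} S → a ^ᴿ p ≈ a → iter n σ̄ (a ·ₛ S) ≈ₛ (a ·ₛ iter n σ̄ S)
    iter-σ̄-·ₛ zero    S a^p≈a = ≈ₛ-refl
    iter-σ̄-·ₛ (suc n) S a^p≈a = ≈ₛ-trans (σ̄-cong (iter-σ̄-·ₛ n S a^p≈a)) (≈ₛ-trans (σ̄-·ₛ _ _) (·ₛ-cong a^p≈a ≈ₛ-refl))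

    iter-σ̄-0ₛ : ∀ n → iter n σ̄ 0ₛ ≈ₛ 0ₛ
    iter-σ̄-0ₛ zero    = ≈ₛ-refl
    iter-σ̄-0ₛ (suc n) = ≈ₛ-trans (σ̄-cong (iter-σ̄-0ₛ n)) σ̄-0ₛ

    iter-σ̄-1ₛ : ∀ n → iter n σ̄ 1ₛ ≈ₛ 1ₛ
    iter-σ̄-1ₛ zero    = ≈ₛ-refl
    iter-σ̄-1ₛ (suc n) = ≈ₛ-trans (σ̄-cong (iter-σ̄-1ₛ n)) σ̄-1ₛ

    order-iter-σ̄ : ∀ {g} → OrderAtLeast 1 g → ∀ n → OrderAtLeast (suc n) (iter n σ̄ g)
    order-iter-σ̄ ord zero    = ord
    order-iter-σ̄ ord (suc n) = order-σ̄ (order-iter-σ̄ ord n)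

    iter-σ̄-summable : ∀ {g} → OrderAtLeast 1 g → Summable (λ n → iter n σ̄ g)
    iter-σ̄-summable ord n = order-≤ (ℕ.n≤1+n n) (order-iter-σ̄ ord n)

    σ̄-Σ∞ : ∀ {F} → Summable F → σ̄ (Σ∞ F) ≈ₛ Σ∞ (λ n → σ̄ (F n))
    σ̄-Σ∞ {F} sF N with multipleView N
    ... | nonmultiple p∤N = trans (σ̄-∤ _ p∤N) (sym (sumTo-zero (suc N) (λ n _ → σ̄-∤ (F n) p∤N)))
    ... | multiple M ≡.refl = begin
      σ̄ (Σ∞ F) (p ℕ.* M)                             ≈⟨ σ̄-p* (Σ∞ F) M ⟩
      Σ∞ F M ^ᴿ p                                    ≈⟨ frob-sumTo (suc M) _ ⟩
      sumTo (suc M) (λ n → F n M ^ᴿ p)               ≈⟨ sumTo-cong (suc M) (λ n → sym (σ̄-p* (F n) M)) ⟩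
      sumTo (suc M) (λ n → σ̄ (F n) (p ℕ.* M))        ≈⟨ sumTo-pad (suc M) (suc (p ℕ.* M)) _ (s≤s (ℕ.m≤n*m M p)) beyond≈0 ⟩
      Σ∞ (λ n → σ̄ (F n)) (p ℕ.* M)                   ∎
      where
      open ≈-Reasoning
      beyond≈0 : ∀ n → suc M ℕ.≤ n → n < suc (p ℕ.* M) → σ̄ (F n) (p ℕ.* M) ≈ 0#
      beyond≈0 n M<n _ = trans (σ̄-p* (F n) M) (trans (frob-cong (sF n M M<n)) frob-0)

    Σ∞-multiples : ∀ {G H} → Summable G → (∀ n → ¬ p ∣ n → G n ≈ₛ 0ₛ) → (∀ m → G (p ℕ.* m) ≈ₛ H m) → Σ∞ G ≈ₛ Σ∞ H
    Σ∞-multiples {G} {H} sG G-∤ G-p* N = begin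
      sumTo (suc N) (λ n → G n N)             ≈⟨ sumTo-pad (suc N) (p ℕ.* suc N) _ (ℕ.m≤n*m (suc N) p) (λ n N<n _ → sG n N N<n) ⟩
      sumTo (p ℕ.* suc N) (λ n → G n N)       ≈⟨ sumTo-multiples p (suc N) _ (λ m r 0<r r<p → G-∤ _ (p∤p*m+r m r 0<r r<p) N) ⟩
      sumTo (suc N) (λ m → G (p ℕ.* m) N)     ≈⟨ sumTo-cong (suc N) (λ m → G-p* m N) ⟩
      sumTo (suc N) (λ m → H m N)             ∎
      where open ≈-Reasoning

    τ̄-cong : ∀ {g h} → g ≈ₛ h → τ̄ g ≈ₛ τ̄ h
    τ̄-cong g≈h = Σ∞-cong (λ n → iter-σ̄-cong n g≈h)

    τ̄-+ₛ : ∀ g h → τ̄ (g +ₛ h) ≈ₛ (τ̄ g +ₛ τ̄ h)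
    τ̄-+ₛ g h N = trans (Σ∞-cong (λ n → iter-σ̄-+ₛ n g h) N) (sumTo-+ (suc N) _ _)

    τ̄-·ₛ : ∀ {a} g → a ^ᴿ p ≈ a → τ̄ (a ·ₛ g) ≈ₛ (a ·ₛ τ̄ g)
    τ̄-·ₛ {a} g a^p≈a N = trans (Σ∞-cong (λ n → iter-σ̄-·ₛ n g a^p≈a) N) (sym (*-sumTo (suc N) a _))

    τ̄-0ₛ : τ̄ 0ₛ ≈ₛ 0ₛ
    τ̄-0ₛ N = sumTo-zero (suc N) (λ n _ → iter-σ̄-0ₛ n N)

    τ̄-sumₛ : ∀ n F → τ̄ (sumₛ n F) ≈ₛ sumₛ n (λ i → τ̄ (F i))
    τ̄-sumₛ zero    F = τ̄-0ₛ
    τ̄-sumₛ (suc n) F = ≈ₛ-trans (τ̄-+ₛ _ _) (+ₛ-cong (τ̄-sumₛ n F) ≈ₛ-refl)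

    τ̄-fixpoint : ∀ g → OrderAtLeast 1 g → τ̄ g ≈ₛ (g +ₛ σ̄ (τ̄ g))
    τ̄-fixpoint g ord = ≈ₛ-trans (Σ∞-head (λ n → iter-σ̄-summable ord (suc n)))
                                (+ₛ-cong ≈ₛ-refl (≈ₛ-sym (σ̄-Σ∞ (iter-σ̄-summable ord))))

    τ̄-σ̄ : ∀ g → OrderAtLeast 1 g → τ̄ g ≈ₛ (g +ₛ τ̄ (σ̄ g))
    τ̄-σ̄ g ord = ≈ₛ-trans (τ̄-fixpoint g ord) (+ₛ-cong ≈ₛ-refl (≈ₛ-trans (σ̄-Σ∞ (iter-σ̄-summable ord))
                   (Σ∞-cong (λ n → ≈ₛ-reflexive (≡.sym (iter-σ̄-comm n g))))))

    τ̄-iter-σ̄ : ∀ m g → OrderAtLeast 1 g → τ̄ g ≈ₛ (sumₛ m (λ n → iter n σ̄ g) +ₛ τ̄ (iter m σ̄ g))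
    τ̄-iter-σ̄ zero    g ord N = sym (+-identityˡ _)
    τ̄-iter-σ̄ (suc m) g ord N =
      trans (τ̄-iter-σ̄ m g ord N) (trans (+-cong refl (τ̄-σ̄ (iter m σ̄ g) (order-≤ (s≤s z≤n) (order-iter-σ̄ ord m)) N)) (sym (+-assoc _ _ _)))

    -- For N > 0 the coefficient of x^N in σ̄ T only involves coefficients of T of index < N.
    fixpoint-unique : ∀ {g A B} → A 0 ≈ B 0 → A ≈ₛ (g +ₛ σ̄ A) → B ≈ₛ (g +ₛ σ̄ B) → A ≈ₛ B
    fixpoint-unique {g} {A} {B} A₀≈B₀ A-fix B-fix N = below (suc N) N (ℕ.n<1+n N)
      where
      below : ∀ K N → N < K → A N ≈ B N
      below (suc K) zero    _     = A₀≈B₀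
      below (suc K) (suc N) N<K = trans (A-fix (suc N)) (trans (+-cong refl σ̄A≈σ̄B) (sym (B-fix (suc N))))
        where
        σ̄A≈σ̄B : σ̄ A (suc N) ≈ σ̄ B (suc N)
        σ̄A≈σ̄B with multipleView (suc N)
        ... | nonmultiple p∤N+1 = trans (σ̄-∤ A p∤N+1) (sym (σ̄-∤ B p∤N+1))
        ... | multiple m N+1≡pm = trans (σ̄-at A m N+1≡pm)
                                    (trans (frob-cong (below K m (ℕ.<-≤-trans (p*m<N⇒m<N N+1≡pm (s≤s z≤n)) (ℕ.≤-pred N<K))))
                                      (sym (σ̄-at B m N+1≡pm)))

    τ̄-unique : ∀ {g T} → OrderAtLeast 1 g → T 0 ≈ 0# → T ≈ₛ (g +ₛ σ̄ T) → T ≈ₛ τ̄ g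
    τ̄-unique {g} ord T₀≈0 T-fix = fixpoint-unique (trans T₀≈0 (sym (trans (+-identityˡ _) (ord 0 (s≤s z≤n))))) T-fix (τ̄-fixpoint g ord)

    module Seriesᴿ = RingFacts Series-commutativeRing p e 0ₛ

    ^ₛ≈^ᴿ : ∀ S n → (S ^ₛ n) ≈ₛ Setup._^ᴿ_ Series-commutativeRing p e 0ₛ S n
    ^ₛ≈^ᴿ S zero    = ≈ₛ-refl
    ^ₛ≈^ᴿ S (suc n) = ⊛-congʳ S (^ₛ≈^ᴿ S n)

    Series-hasChar : Setup.HasChar Series-commutativeRing p e 0ₛ
    Series-hasChar N = trans (fromℕ≈ p N) (trans (*-cong char refl) (zeroˡ _))
      where
      fromℕ≈ : ∀ n → Setup.fromℕᴿ Series-commutativeRing p e 0ₛ n ≈ₛ (fromℕᴿ n ·ₛ 1ₛ)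
      fromℕ≈ zero    N = sym (zeroˡ _)
      fromℕ≈ (suc n) N = trans (+-cong (sym (*-identityˡ _)) (fromℕ≈ n N)) (sym (distribʳ _ _ _))

    module FrobeniusSeries = Seriesᴿ.Frobenius pr Series-hasChar

    ^ₛ-cong : ∀ {S T} n → S ≈ₛ T → (S ^ₛ n) ≈ₛ (T ^ₛ n)
    ^ₛ-cong zero    S≈T = ≈ₛ-refl
    ^ₛ-cong (suc n) S≈T = ⊛-cong S≈T (^ₛ-cong n S≈T)

    ^ₛ-* : ∀ S m n → (S ^ₛ (m ℕ.* n)) ≈ₛ ((S ^ₛ m) ^ₛ n)
    ^ₛ-* S m n = ≈ₛ-trans (^ₛ≈^ᴿ S (m ℕ.* n)) (≈ₛ-trans (Seriesᴿ.^ᴿ-* S m n)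
                   (≈ₛ-sym (≈ₛ-trans (^ₛ≈^ᴿ _ n) (Seriesᴿ.^ᴿ-cong n (^ₛ≈^ᴿ S m)))))

    frobₛ-+ₛ : ∀ S T → ((S +ₛ T) ^ₛ p) ≈ₛ ((S ^ₛ p) +ₛ (T ^ₛ p))
    frobₛ-+ₛ S T = ≈ₛ-trans (^ₛ≈^ᴿ _ p) (≈ₛ-trans (FrobeniusSeries.frob-+ S T) (≈ₛ-sym (+ₛ-cong (^ₛ≈^ᴿ S p) (^ₛ≈^ᴿ T p))))

    frobₛ-⊛ : ∀ S T → ((S ⊛ T) ^ₛ p) ≈ₛ ((S ^ₛ p) ⊛ (T ^ₛ p))
    frobₛ-⊛ S T = ≈ₛ-trans (^ₛ≈^ᴿ _ p) (≈ₛ-trans (FrobeniusSeries.frob-* S T) (≈ₛ-sym (⊛-cong (^ₛ≈^ᴿ S p) (^ₛ≈^ᴿ T p))))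

    frobₛ-0ₛ : (0ₛ ^ₛ p) ≈ₛ 0ₛ
    frobₛ-0ₛ = ≈ₛ-trans (^ₛ≈^ᴿ _ p) FrobeniusSeries.frob-0

    σ̄-^ₛ : ∀ S n → σ̄ (S ^ₛ n) ≈ₛ (σ̄ S ^ₛ n)
    σ̄-^ₛ S zero    = σ̄-1ₛ
    σ̄-^ₛ S (suc n) = ≈ₛ-trans (σ̄-⊛ S _) (⊛-congʳ (σ̄ S) (σ̄-^ₛ S n))

    monomial-^ₛ : ∀ a i n → (monomial a i ^ₛ n) ≈ₛ monomial (a ^ᴿ n) (i ℕ.* n)
    monomial-^ₛ a i zero    = ≈ₛ-trans 1ₛ≈monomial (≈ₛ-reflexive (≡.cong (monomial 1#) (≡.sym (ℕ.*-zeroʳ i))))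
    monomial-^ₛ a i (suc n) = ≈ₛ-trans (⊛-congʳ (monomial a i) (monomial-^ₛ a i n))
      (≈ₛ-trans (monomial-⊛-monomial a i _ _) (≈ₛ-reflexive (≡.cong (monomial _) (≡.sym (ℕ.*-suc i n)))))

    -- Holds because Frobenius fixes the F_p-coefficients of f.
    σ̄-fSeries : ∀ f → σ̄ (fSeries f) ≈ₛ (fSeries f ^ₛ p)
    σ̄-fSeries [] = ≈ₛ-trans (σ̄-cong fSeries-[]) (≈ₛ-trans σ̄-0ₛ (≈ₛ-sym (≈ₛ-trans (^ₛ-cong p fSeries-[]) frobₛ-0ₛ)))
      where
      fSeries-[] : fSeries [] ≈ₛ 0ₛ
      fSeries-[] zero    = refl
      fSeries-[] (suc N) = refl
    σ̄-fSeries (a ∷ as) = begin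
      σ̄ (fSeries (a ∷ as))                                              ≈⟨ σ̄-cong (fSeries-∷ a as) ⟩
      σ̄ (monomial (ι a) 1 +ₛ (x̂ ⊛ fSeries as))                         ≈⟨ σ̄-+ₛ _ _ ⟩
      σ̄ (monomial (ι a) 1) +ₛ σ̄ (x̂ ⊛ fSeries as)                       ≈⟨ +ₛ-cong ≈ₛ-refl (σ̄-⊛ x̂ _) ⟩
      σ̄ (monomial (ι a) 1) +ₛ (σ̄ x̂ ⊛ σ̄ (fSeries as))                  ≈⟨ +ₛ-cong (≈ₛ-sym (x^p≈ (ι a))) (⊛-cong (≈ₛ-sym (x^p≈ 1#)) (σ̄-fSeries as)) ⟩
      (monomial (ι a) 1 ^ₛ p) +ₛ ((x̂ ^ₛ p) ⊛ (fSeries as ^ₛ p))        ≈⟨ +ₛ-cong ≈ₛ-refl (≈ₛ-sym (frobₛ-⊛ x̂ _)) ⟩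
      (monomial (ι a) 1 ^ₛ p) +ₛ ((x̂ ⊛ fSeries as) ^ₛ p)               ≈⟨ frobₛ-+ₛ _ _ ⟨
      ((monomial (ι a) 1 +ₛ (x̂ ⊛ fSeries as)) ^ₛ p)                    ≈⟨ ^ₛ-cong p (fSeries-∷ a as) ⟨
      (fSeries (a ∷ as) ^ₛ p)                                           ∎
      where
      open ≈ₛ-Reasoning
      x^p≈ : ∀ b → (monomial b 1 ^ₛ p) ≈ₛ σ̄ (monomial b 1)
      x^p≈ b = ≈ₛ-trans (monomial-^ₛ b 1 p) (≈ₛ-trans (≈ₛ-reflexive (≡.cong (monomial _) (ℕ.*-comm 1 p))) (≈ₛ-sym (σ̄-monomial b 1)))

    module _ {f} (order-f : OrderAtLeast 1 f) (σ̄f≈f^p : σ̄ f ≈ₛ (f ^ₛ p)) where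

      subst-σ̄ : ∀ h → subst (σ̄ h) f ≈ₛ σ̄ (subst h f)
      subst-σ̄ h = begin
        subst (σ̄ h) f                           ≈⟨ Σ∞-multiples (subst-summable order-f (σ̄ h)) σ̄h-∤ σ̄h-p* ⟩
        Σ∞ (λ m → (h m ^ᴿ p) ·ₛ (f ^ₛ (p ℕ.* m))) ≈⟨ Σ∞-cong (λ m → ≈ₛ-sym (σ̄-term m)) ⟩
        Σ∞ (λ m → σ̄ (h m ·ₛ (f ^ₛ m)))           ≈⟨ σ̄-Σ∞ (subst-summable order-f h) ⟨
        σ̄ (subst h f)                           ∎
        where
        open ≈ₛ-Reasoning
        σ̄h-∤ : ∀ n → ¬ p ∣ n → (σ̄ h n ·ₛ (f ^ₛ n)) ≈ₛ 0ₛ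
        σ̄h-∤ n p∤n N = trans (*-cong (σ̄-∤ h p∤n) refl) (zeroˡ _)
        σ̄h-p* : ∀ m → (σ̄ h (p ℕ.* m) ·ₛ (f ^ₛ (p ℕ.* m))) ≈ₛ ((h m ^ᴿ p) ·ₛ (f ^ₛ (p ℕ.* m)))
        σ̄h-p* m N = *-cong (σ̄-p* h m) refl
        σ̄-term : ∀ m → σ̄ (h m ·ₛ (f ^ₛ m)) ≈ₛ ((h m ^ᴿ p) ·ₛ (f ^ₛ (p ℕ.* m)))
        σ̄-term m = ≈ₛ-trans (σ̄-·ₛ (h m) _) (·ₛ-congʳ _ (≈ₛ-trans (σ̄-^ₛ f m) (≈ₛ-trans (^ₛ-cong m σ̄f≈f^p) (≈ₛ-sym (^ₛ-* f p m)))))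

      -- Both sides solve T = h(f) + σ̄ T with T(0) = 0.
      subst-τ̄ : ∀ h → OrderAtLeast 1 h → subst (τ̄ h) f ≈ₛ τ̄ (subst h f)
      subst-τ̄ h order-h = τ̄-unique order-h∘f (trans (subst-at-0 (τ̄ h) f) (trans (+-identityˡ _) (order-h 0 (s≤s z≤n)))) fixpoint
        where
        order-h∘f : OrderAtLeast 1 (subst h f)
        order-h∘f zero    _        = trans (subst-at-0 h f) (order-h 0 (s≤s z≤n))
        order-h∘f (suc N) (s≤s ())
        fixpoint : subst (τ̄ h) f ≈ₛ (subst h f +ₛ σ̄ (subst (τ̄ h) f))
        fixpoint = ≈ₛ-trans (subst-cong f (τ̄-fixpoint h order-h)) (≈ₛ-trans (subst-+ₛ h _ f) (+ₛ-cong ≈ₛ-refl (subst-σ̄ (τ̄ h))))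

    ω̄∘f-suc : ∀ f k → subst (ω̄ (suc k)) (fSeries f) ≈ₛ τ̄ (fSeries f ⊛ subst (ω̄ k) (fSeries f))
    ω̄∘f-suc f k = ≈ₛ-trans (subst-τ̄ (order-fSeries f) (σ̄-fSeries f) (x̂ ⊛ ω̄ k) (order-⊛ (order-monomial 1# 1) (order≥0 (ω̄ k))))
                           (τ̄-cong (subst-x̂⊛ (order-fSeries f) (ω̄ k)))

  restrict : ∀ {m} → (Fin m → Carrier) → ℕ → Carrier
  restrict {m} g n with n ℕ.<? m
  ... | yes n<m = g (fromℕ< n<m)
  ... | no _    = 0#

  sumTo-restrict : ∀ m (g : Fin m → Carrier) → sumTo m (restrict g) ≈ sum g
  sumTo-restrict zero    g = refl
  sumTo-restrict (suc m) g = trans (sumTo-head m (restrict g))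
    (+-cong restrict-0 (trans (sumTo-cong m restrict-suc) (sumTo-restrict m (g ∘ Fin.suc))))
    where
    restrict-0 : restrict g 0 ≈ g Fin.zero
    restrict-0 with 0 ℕ.<? suc m
    ... | yes _ = refl
    ... | no 0≮m+1 = ⊥-elim (0≮m+1 (s≤s z≤n))
    restrict-suc : ∀ n → restrict g (suc n) ≈ restrict (g ∘ Fin.suc) n
    restrict-suc n with suc n ℕ.<? suc m | n ℕ.<? m
    ... | yes _      | yes _   = refl
    ... | no _       | no _    = refl
    ... | yes n+1<m+1 | no n≮m = ⊥-elim (n≮m (ℕ.≤-pred n+1<m+1))
    ... | no n+1≮m+1 | yes n<m = ⊥-elim (n+1≮m+1 (s≤s n<m))

  sum-monomial : ∀ {m} (a g : Fin m → Carrier) i → (λ N → sum (λ j → a j * monomial (g j) i N)) ≈ₛ monomial (sum (λ j → a j * g j)) i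
  sum-monomial {m} a g i N with N ℕ.≟ i
  ... | yes _ = refl
  ... | no _  = trans (sum-cong-≋ (λ j → zeroʳ (a j))) (sum-replicate-zero m)

  record Term (n : ℕ) : Set c where
    constructor term
    field
      coeff  : Carrier
      power  : ℕ
      depth  : ℕ
      depth< : depth < n
      datum  : IFDatum depth

  ⟦_⟧ : ∀ {n} → List (Term n) → Series
  ⟦ [] ⟧                   = 0ₛ
  ⟦ term a k d _ b ∷ ts ⟧ = (monomial a k ⊛ w̄ d b) +ₛ ⟦ ts ⟧

  Span : ℕ → Series → Set (c ⊔ ℓ)
  Span n T = Σ (List (Term n)) λ ts → T ≈ₛ ⟦ ts ⟧

  _≅_[mod_] : Series → Series → ℕ → Set (c ⊔ ℓ)
  S ≅ T [mod n ] = Σ Series λ D → Span n D × S ≈ₛ (T +ₛ D)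

  span-cong : ∀ {n S T} → S ≈ₛ T → Span n S → Span n T
  span-cong S≈T (ts , S≈ts) = ts , ≈ₛ-trans (≈ₛ-sym S≈T) S≈ts

  span-0ₛ : ∀ {n} → Span n 0ₛ
  span-0ₛ = [] , ≈ₛ-refl

  span-term : ∀ {n} a k d (b : IFDatum d) → d < n → Span n (monomial a k ⊛ w̄ d b)
  span-term a k d b d<n = term a k d d<n b ∷ [] , λ N → sym (+-identityʳ _)

  span-+ₛ : ∀ {n S T} → Span n S → Span n T → Span n (S +ₛ T)
  span-+ₛ (ss , S≈ss) (ts , T≈ts) = ss ++ ts , ≈ₛ-trans (+ₛ-cong S≈ss T≈ts) (≈ₛ-sym (⟦⟧-++ ss ts))
    where
    ⟦⟧-++ : ∀ {n} (ss ts : List (Term n)) → ⟦ ss ++ ts ⟧ ≈ₛ (⟦ ss ⟧ +ₛ ⟦ ts ⟧)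
    ⟦⟧-++ []                    ts N = sym (+-identityˡ _)
    ⟦⟧-++ (term a k d _ b ∷ ss) ts N = trans (+-cong refl (⟦⟧-++ ss ts N)) (sym (+-assoc _ _ _))

  span-monomial-⊛ : ∀ {n T} a k → Span n T → Span n (monomial a k ⊛ T)
  span-monomial-⊛ {n} a k (ts , T≈ts) = List.map shift ts , ≈ₛ-trans (⊛-congʳ _ T≈ts) (⟦⟧-shift ts)
    where
    shift : Term n → Term n
    shift (term a′ k′ d d<n b) = term (a * a′) (k ℕ.+ k′) d d<n b
    ⟦⟧-shift : ∀ ts → (monomial a k ⊛ ⟦ ts ⟧) ≈ₛ ⟦ List.map shift ts ⟧
    ⟦⟧-shift []                     = ⊛-zeroʳ _
    ⟦⟧-shift (term a′ k′ d _ b ∷ ts) = ≈ₛ-trans (⊛-distribˡ (monomial a k) (monomial a′ k′ ⊛ w̄ d b) ⟦ ts ⟧)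
                                         (+ₛ-cong (monomial-⊛-monomial-⊛ a k a′ k′ (w̄ d b)) (⟦⟧-shift ts))

  span-·ₛ : ∀ {n T} a → Span n T → Span n (a ·ₛ T)
  span-·ₛ {T = T} a span = span-cong monomial-⊛≈·ₛ (span-monomial-⊛ a 0 span)
    where
    monomial≈·ₛ1ₛ : monomial a 0 ≈ₛ (a ·ₛ 1ₛ)
    monomial≈·ₛ1ₛ = ≈ₛ-trans (monomial-cong 0 (sym (*-identityʳ a))) (≈ₛ-trans (monomial-* a 1# 0) (·ₛ-congʳ a (≈ₛ-sym 1ₛ≈monomial)))
    monomial-⊛≈·ₛ : (monomial a 0 ⊛ T) ≈ₛ (a ·ₛ T)
    monomial-⊛≈·ₛ = ≈ₛ-trans (⊛-congˡ T monomial≈·ₛ1ₛ) (≈ₛ-trans (·ₛ-⊛ a 1ₛ T) (·ₛ-congʳ a (⊛-identityˡ T)))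

  span--ₛ : ∀ {n T} → Span n T → Span n (-ₛ T)
  span--ₛ span = span-cong (≈ₛ-sym (-ₛ≈-1·ₛ _)) (span-·ₛ (- 1#) span)

  span-≤ : ∀ {m n T} → m ℕ.≤ n → Span m T → Span n T
  span-≤ {m} {n} m≤n (ts , T≈ts) = List.map lift ts , ≈ₛ-trans T≈ts (⟦⟧-lift ts)
    where
    lift : Term m → Term n
    lift (term a k d d<m b) = term a k d (ℕ.<-≤-trans d<m m≤n) b
    ⟦⟧-lift : ∀ ts → ⟦ ts ⟧ ≈ₛ ⟦ List.map lift ts ⟧
    ⟦⟧-lift []                    = ≈ₛ-refl
    ⟦⟧-lift (term a k d _ b ∷ ts) = +ₛ-cong ≈ₛ-refl (⟦⟧-lift ts)

  span-sumₛ : ∀ {n} m {F} → (∀ i → i < m → Span n (F i)) → Span n (sumₛ m F)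
  span-sumₛ zero    span-F = span-0ₛ
  span-sumₛ (suc m) span-F = span-+ₛ (span-sumₛ m (λ i i<m → span-F i (ℕ.m<n⇒m<1+n i<m))) (span-F m (ℕ.n<1+n m))

  ≈⇒≅ : ∀ {n S T} → S ≈ₛ T → S ≅ T [mod n ]
  ≈⇒≅ S≈T = 0ₛ , span-0ₛ , λ N → trans (S≈T N) (sym (+-identityʳ _))

  ≅-trans : ∀ {n S T U} → S ≅ T [mod n ] → T ≅ U [mod n ] → S ≅ U [mod n ]
  ≅-trans (D , span-D , S≈T+D) (E , span-E , T≈U+E) =
    E +ₛ D , span-+ₛ span-E span-D , λ N → trans (S≈T+D N) (trans (+-cong (T≈U+E N) refl) (+-assoc _ _ _))

  ≅-+ₛ : ∀ {n S S′ T T′} → S ≅ S′ [mod n ] → T ≅ T′ [mod n ] → (S +ₛ T) ≅ (S′ +ₛ T′) [mod n ]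
  ≅-+ₛ (D , span-D , S≈S′+D) (E , span-E , T≈T′+E) =
    D +ₛ E , span-+ₛ span-D span-E , λ N → trans (+-cong (S≈S′+D N) (T≈T′+E N)) (interchange _ _ _ _)

  ≅-·ₛ : ∀ {n S T} a → S ≅ T [mod n ] → (a ·ₛ S) ≅ (a ·ₛ T) [mod n ]
  ≅-·ₛ a (D , span-D , S≈T+D) = a ·ₛ D , span-·ₛ a span-D , ≈ₛ-trans (·ₛ-congʳ a S≈T+D) (·ₛ-+ₛ a _ D)

  ≅-sumₛ : ∀ {n} m {F G} → (∀ i → F i ≅ G i [mod n ]) → sumₛ m F ≅ sumₛ m G [mod n ]
  ≅-sumₛ zero    F≅G = ≈⇒≅ ≈ₛ-refl
  ≅-sumₛ (suc m) F≅G = ≅-+ₛ (≅-sumₛ m F≅G) (F≅G m)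

  span⇒≅0ₛ : ∀ {n D} → Span n D → D ≅ 0ₛ [mod n ]
  span⇒≅0ₛ span-D = _ , span-D , λ N → sym (+-identityˡ _)

  ≅⇒span-difference : ∀ {n S T} → S ≅ T [mod n ] → Span n (S -ₛ T)
  ≅⇒span-difference {S = S} {T} (D , span-D , S≈T+D) = span-cong (λ N → sym (S-T≈D N)) span-D
    where
    S-T≈D : (S -ₛ T) ≈ₛ D
    S-T≈D N = trans (+-cong (S≈T+D N) refl) (xyx⁻¹≈y (T N) (D N))

  polySeries-monomial : ∀ a k → polySeries (List.replicate k 0# ++ a ∷ []) ≈ₛ monomial a k
  polySeries-monomial a zero    zero    = sym (monomial-same a 0)
  polySeries-monomial a zero    (suc N) = sym (monomial-≢ a 0 (suc N) (λ ()))
  polySeries-monomial a (suc k) zero    = sym (monomial-≢ a (suc k) 0 (λ ()))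
  polySeries-monomial a (suc k) (suc N) = trans (polySeries-monomial a k N) (monomial-suc N)
    where
    monomial-suc : ∀ N → monomial a k N ≈ monomial a (suc k) (suc N)
    monomial-suc N with N ℕ.≟ k
    ... | yes ≡.refl = sym (monomial-same a (suc N))
    ... | no N≢k     = sym (monomial-≢ a (suc k) (suc N) (N≢k ∘ ℕ.suc-injective))

  span⇒InM̄ : ∀ {m T} → ¬ (1# ≈ 0#) → Span (suc m) T → InM̄ m T
  span⇒InM̄ {m} {T} 1≉0 (ts , T≈ts) = 1# ∷ [] , here 1≉0 , List.map toSpanTerm ts , 1⊛T≈
    where
    open import Data.List.Relation.Unary.Any using (here)
    toSpanTerm : Term (suc m) → SpanTerm m
    toSpanTerm (term a k d (s≤s d≤m) b) = term d d≤m b (List.replicate k 0# ++ a ∷ [])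
    ⟦⟧≈sumTerms : ∀ ts → ⟦ ts ⟧ ≈ₛ sumTerms (List.map toSpanTerm ts)
    ⟦⟧≈sumTerms []                            = ≈ₛ-refl
    ⟦⟧≈sumTerms (term a k d (s≤s _) b ∷ ts) = +ₛ-cong (⊛-congˡ (w̄ d b) (≈ₛ-sym (polySeries-monomial a k))) (⟦⟧≈sumTerms ts)
    polySeries-1 : polySeries (1# ∷ []) ≈ₛ 1ₛ
    polySeries-1 zero    = refl
    polySeries-1 (suc N) = refl
    1⊛T≈ : (polySeries (1# ∷ []) ⊛ T) ≈ₛ sumTerms (List.map toSpanTerm ts)
    1⊛T≈ = ≈ₛ-trans (⊛-congˡ T polySeries-1) (≈ₛ-trans (⊛-identityˡ T) (≈ₛ-trans T≈ts (⟦⟧≈sumTerms ts)))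

  module _ (pr : Prime p) (char : HasChar) where
    open Frobenius pr char
    open CharacteristicP pr char

    order-xSeries-⊛ : ∀ z S → OrderAtLeast 1 (xSeries z ⊛ S)
    order-xSeries-⊛ z S = order-≤ (Xel.1≤i z) (order-monomial-⊛ (ζpow (Xel.j z)) (Xel.i z) S)

    w̄-fixpoint : ∀ d (b : IFDatum (suc d)) →
      w̄ (suc d) b ≈ₛ ((xSeries (b (fromℕ d)) ⊛ w̄ d (b ∘ inject₁)) +ₛ σ̄ (w̄ (suc d) b))
    w̄-fixpoint d b = τ̄-fixpoint _ (order-xSeries-⊛ (b (fromℕ d)) (w̄ d (b ∘ inject₁)))

    σ̄-w̄ : ∀ d (b : IFDatum (suc d)) →
      σ̄ (w̄ (suc d) b) ≈ₛ (w̄ (suc d) b +ₛ (-ₛ (xSeries (b (fromℕ d)) ⊛ w̄ d (b ∘ inject₁))))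
    σ̄-w̄ d b N = sym (trans (+-cong (w̄-fixpoint d b N) refl) (xyx⁻¹≈y _ _))

    -- σ̄ w̄_b = w̄_b − x_{b(d)} w̄_{b^tr}, and σ̄ (a x^k) = a^p x^{pk}.
    span-σ̄ : ∀ {n T} → Span n T → Span n (σ̄ T)
    span-σ̄ {n} (ts , T≈ts) = span-cong (≈ₛ-sym (σ̄-cong T≈ts)) (over-terms ts)
      where
      σ̄-term : ∀ a k d (b : IFDatum d) → d < n → Span n (σ̄ (monomial a k ⊛ w̄ d b))
      σ̄-term a k zero b d<n =
        span-cong (≈ₛ-sym (≈ₛ-trans (σ̄-⊛ (monomial a k) (w̄ 0 b)) (⊛-cong (σ̄-monomial a k) σ̄-1ₛ)))
                  (span-term (a ^ᴿ p) (p ℕ.* k) 0 b d<n)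
      σ̄-term a k (suc d) b d<n =
        span-cong (≈ₛ-sym σ̄-term≈)
                  (span-+ₛ (span-term (a ^ᴿ p) (p ℕ.* k) (suc d) b d<n)
                           (span--ₛ (span-monomial-⊛ (a ^ᴿ p) (p ℕ.* k)
                             (span-term (ζpow (Xel.j z)) (Xel.i z) d (b ∘ inject₁) (ℕ.<-trans (ℕ.n<1+n d) d<n)))))
        where
        z = b (fromℕ d)
        M = monomial (a ^ᴿ p) (p ℕ.* k)
        X = xSeries z ⊛ w̄ d (b ∘ inject₁)
        σ̄-term≈ : σ̄ (monomial a k ⊛ w̄ (suc d) b) ≈ₛ ((M ⊛ w̄ (suc d) b) +ₛ (-ₛ (M ⊛ X)))
        σ̄-term≈ = begin
          σ̄ (monomial a k ⊛ w̄ (suc d) b)        ≈⟨ σ̄-⊛ (monomial a k) (w̄ (suc d) b) ⟩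
          σ̄ (monomial a k) ⊛ σ̄ (w̄ (suc d) b)    ≈⟨ ⊛-cong (σ̄-monomial a k) (σ̄-w̄ d b) ⟩
          M ⊛ (w̄ (suc d) b +ₛ (-ₛ X))            ≈⟨ ⊛-distribˡ M (w̄ (suc d) b) (-ₛ X) ⟩
          (M ⊛ w̄ (suc d) b) +ₛ (M ⊛ (-ₛ X))      ≈⟨ +ₛ-cong ≈ₛ-refl (⊛-congʳ M (-ₛ≈-1·ₛ X)) ⟩
          (M ⊛ w̄ (suc d) b) +ₛ (M ⊛ ((- 1#) ·ₛ X)) ≈⟨ +ₛ-cong ≈ₛ-refl (⊛-·ₛ (- 1#) M X) ⟩
          (M ⊛ w̄ (suc d) b) +ₛ ((- 1#) ·ₛ (M ⊛ X)) ≈⟨ +ₛ-cong ≈ₛ-refl (-ₛ≈-1·ₛ (M ⊛ X)) ⟨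
          (M ⊛ w̄ (suc d) b) +ₛ (-ₛ (M ⊛ X))       ∎
          where open ≈ₛ-Reasoning
      over-terms : ∀ ts → Span n (σ̄ ⟦ ts ⟧)
      over-terms []                      = span-cong (≈ₛ-sym σ̄-0ₛ) span-0ₛ
      over-terms (term a k d d<n b ∷ ts) = span-cong (≈ₛ-sym (σ̄-+ₛ _ ⟦ ts ⟧)) (span-+ₛ (σ̄-term a k d b d<n) (over-terms ts))

    span-iter-σ̄ : ∀ {n T} m → Span n T → Span n (iter m σ̄ T)
    span-iter-σ̄ zero    span = span
    span-iter-σ̄ (suc m) span = span-σ̄ (span-iter-σ̄ m span)

    w̄≅iter-σ̄-w̄ : ∀ d (b : IFDatum d) m → w̄ d b ≅ iter m σ̄ (w̄ d b) [mod d ]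
    w̄≅iter-σ̄-w̄ zero    b m = 0ₛ , span-0ₛ , λ N → trans (sym (iter-σ̄-1ₛ m N)) (sym (+-identityʳ _))
    w̄≅iter-σ̄-w̄ (suc d) b zero = 0ₛ , span-0ₛ , λ N → sym (+-identityʳ _)
    w̄≅iter-σ̄-w̄ (suc d) b (suc m) with w̄≅iter-σ̄-w̄ (suc d) b m
    ... | D , span-D , W≈σ̄ᵐW+D = X +ₛ σ̄ D , span-+ₛ span-X (span-σ̄ span-D) , W≈σ̄ᵐ⁺¹W+X+σ̄D
      where
      z = b (fromℕ d)
      W = w̄ (suc d) b
      X = xSeries z ⊛ w̄ d (b ∘ inject₁)
      span-X : Span (suc d) X
      span-X = span-term (ζpow (Xel.j z)) (Xel.i z) d (b ∘ inject₁) (ℕ.n<1+n d)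
      W≈σ̄ᵐ⁺¹W+X+σ̄D : W ≈ₛ (iter (suc m) σ̄ W +ₛ (X +ₛ σ̄ D))
      W≈σ̄ᵐ⁺¹W+X+σ̄D N = begin
        W N                                        ≈⟨ w̄-fixpoint d b N ⟩
        X N + σ̄ W N                                ≈⟨ +-cong refl (σ̄-cong W≈σ̄ᵐW+D N) ⟩
        X N + σ̄ (iter m σ̄ W +ₛ D) N                ≈⟨ +-cong refl (σ̄-+ₛ _ D N) ⟩
        X N + (iter (suc m) σ̄ W N + σ̄ D N)         ≈⟨ x∙yz≈y∙xz _ _ _ ⟩
        iter (suc m) σ̄ W N + (X N + σ̄ D N)         ∎
        where
        open ≈-Reasoning

    iter-σ̄-monomial-⊛ : ∀ m a i W → iter m σ̄ (monomial a i ⊛ W) ≈ₛ (monomial (frob^ m a) (i ℕ.* p ℕ.^ m) ⊛ iter m σ̄ W)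
    iter-σ̄-monomial-⊛ zero a i W =
      ⊛-congˡ W (≈ₛ-trans (monomial-cong i (sym (*-identityʳ a))) (≈ₛ-reflexive (≡.cong (monomial (a * 1#)) (≡.sym (ℕ.*-identityʳ i)))))
    iter-σ̄-monomial-⊛ (suc m) a i W = begin
      σ̄ (iter m σ̄ (monomial a i ⊛ W))                                              ≈⟨ σ̄-cong (iter-σ̄-monomial-⊛ m a i W) ⟩
      σ̄ (monomial (frob^ m a) (i ℕ.* p ℕ.^ m) ⊛ iter m σ̄ W)                         ≈⟨ σ̄-⊛ _ (iter m σ̄ W) ⟩
      σ̄ (monomial (frob^ m a) (i ℕ.* p ℕ.^ m)) ⊛ iter (suc m) σ̄ W                   ≈⟨ ⊛-congˡ (iter (suc m) σ̄ W) (σ̄-monomial _ _) ⟩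
      monomial (frob^ m a ^ᴿ p) (p ℕ.* (i ℕ.* p ℕ.^ m)) ⊛ iter (suc m) σ̄ W          ≈⟨ ⊛-congˡ (iter (suc m) σ̄ W) (monomial-cong _ frob^-frob) ⟩
      monomial (frob^ (suc m) a) (p ℕ.* (i ℕ.* p ℕ.^ m)) ⊛ iter (suc m) σ̄ W         ≡⟨ ≡.cong (λ t → monomial (frob^ (suc m) a) t ⊛ iter (suc m) σ̄ W) (ℕ-x∙yz≈y∙xz p i (p ℕ.^ m)) ⟩
      monomial (frob^ (suc m) a) (i ℕ.* p ℕ.^ suc m) ⊛ iter (suc m) σ̄ W             ∎
      where
      open ≈ₛ-Reasoning
      open import Algebra.Properties.CommutativeSemigroup ℕ.*-commutativeSemigroup using () renaming (x∙yz≈y∙xz to ℕ-x∙yz≈y∙xz)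
      frob^-frob : frob^ m a ^ᴿ p ≈ frob^ (suc m) a
      frob^-frob = trans (sym (^ᴿ-* a (p ℕ.^ m) p)) (reflexive (≡.cong (a ^ᴿ_) (ℕ.*-comm (p ℕ.^ m) p)))

    module _ {n} (τ̄-x̂⊛-span< : ∀ {T} → Span n T → Span (suc n) (τ̄ (x̂ ⊛ T))) where

      τ̄-monomial-⊛-span : ∀ {T} a k → 1 ℕ.≤ k → Span n T → Span (suc n) (τ̄ (monomial a k ⊛ T))
      τ̄-monomial-⊛-span {T} a (suc k) _ span = span-cong (τ̄-cong (x̂-⊛-monomial-⊛ a k T)) (τ̄-x̂⊛-span< (span-monomial-⊛ a k span))

      -- Under τ̄, the monomial c^(p^m) x^(i p^m) in front of w̄ b may be replaced by c x^i, because
      -- τ̄ (σ̄ᵐ g) ≡ τ̄ g and σ̄ᵐ w̄ b ≡ w̄ b modulo lower depth.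
      τ̄-reduce-exponent : ∀ {c₀ c} i m d (b : IFDatum d) → d ℕ.≤ n → frob^ m c ≈ c₀ → 1 ℕ.≤ i →
        τ̄ (monomial c₀ (i ℕ.* p ℕ.^ m) ⊛ w̄ d b) ≅ τ̄ (monomial c i ⊛ w̄ d b) [mod suc n ]
      τ̄-reduce-exponent {c₀} {c} i m d b d≤n frob^c≈c₀ 1≤i with w̄≅iter-σ̄-w̄ d b m
      ... | D , span-D , W≈σ̄ᵐW+D = (-ₛ Σσ̄ⁿh) +ₛ τ̄ (A ⊛ D) , span-+ₛ (span--ₛ span-Σσ̄ⁿh) span-τ̄A⊛D , τ̄A⊛W≈
        where
        a = i ℕ.* p ℕ.^ m
        W = w̄ d b
        A = monomial c₀ a
        h = monomial c i ⊛ W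
        Σσ̄ⁿh = sumₛ m (λ k → iter k σ̄ h)
        span-Σσ̄ⁿh : Span (suc n) Σσ̄ⁿh
        span-Σσ̄ⁿh = span-sumₛ m (λ k _ → span-iter-σ̄ k (span-term c i d b (s≤s d≤n)))
        span-τ̄A⊛D : Span (suc n) (τ̄ (A ⊛ D))
        span-τ̄A⊛D = τ̄-monomial-⊛-span c₀ a (ℕ.≤-trans 1≤i (ℕ.m≤m*n i (p ℕ.^ m) ⦃ ℕ.m^n≢0 p m ⦄)) (span-≤ d≤n span-D)
        A⊛W≈ : (A ⊛ W) ≈ₛ (iter m σ̄ h +ₛ (A ⊛ D))
        A⊛W≈ = begin
          A ⊛ W                                                 ≈⟨ ⊛-congʳ A W≈σ̄ᵐW+D ⟩
          A ⊛ (iter m σ̄ W +ₛ D)                                 ≈⟨ ⊛-distribˡ A (iter m σ̄ W) D ⟩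
          (A ⊛ iter m σ̄ W) +ₛ (A ⊛ D)                           ≈⟨ +ₛ-cong (⊛-congˡ (iter m σ̄ W) (monomial-cong a frob^c≈c₀)) ≈ₛ-refl ⟨
          (monomial (frob^ m c) a ⊛ iter m σ̄ W) +ₛ (A ⊛ D)      ≈⟨ +ₛ-cong (iter-σ̄-monomial-⊛ m c i W) ≈ₛ-refl ⟨
          iter m σ̄ h +ₛ (A ⊛ D)                                 ∎
          where open ≈ₛ-Reasoning
        τ̄A⊛W≈ : τ̄ (A ⊛ W) ≈ₛ (τ̄ h +ₛ ((-ₛ Σσ̄ⁿh) +ₛ τ̄ (A ⊛ D)))
        τ̄A⊛W≈ N = begin
          τ̄ (A ⊛ W) N                                       ≈⟨ τ̄-cong A⊛W≈ N ⟩
          τ̄ (iter m σ̄ h +ₛ (A ⊛ D)) N                       ≈⟨ τ̄-+ₛ (iter m σ̄ h) (A ⊛ D) N ⟩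
          τ̄ (iter m σ̄ h) N + τ̄ (A ⊛ D) N                    ≈⟨ +-cong τ̄σ̄ᵐh≈ refl ⟩
          (τ̄ h N - Σσ̄ⁿh N) + τ̄ (A ⊛ D) N                   ≈⟨ +-assoc _ _ _ ⟩
          τ̄ h N + (- Σσ̄ⁿh N + τ̄ (A ⊛ D) N)                 ∎
          where
          open ≈-Reasoning
          τ̄σ̄ᵐh≈ : τ̄ (iter m σ̄ h) N ≈ τ̄ h N - Σσ̄ⁿh N
          τ̄σ̄ᵐh≈ = trans (sym (xyx⁻¹≈y (Σσ̄ⁿh N) (τ̄ (iter m σ̄ h) N)))
                         (+-cong (sym (τ̄-iter-σ̄ m h (order-≤ 1≤i (order-monomial-⊛ c i W)) N)) refl)

    frob-coefFp : ∀ g n → coefFp g n ^ᴿ p ≈ coefFp g n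
    frob-coefFp []      n       = frob-0
    frob-coefFp (a ∷ g) zero    = frob-ι a
    frob-coefFp (a ∷ g) (suc n) = frob-coefFp g n

    span-τ̄-monomial-sum : ∀ {n m} i W (g : Fin m → Carrier) → (∀ j → Span n (τ̄ (monomial (g j) i ⊛ W))) →
                          Span n (τ̄ (monomial (sum g) i ⊛ W))
    span-τ̄-monomial-sum {m = zero}  i W g span-g =
      span-cong (≈ₛ-sym (≈ₛ-trans (τ̄-cong (≈ₛ-trans (⊛-congˡ W (monomial-0# i)) (⊛-zeroˡ W))) τ̄-0ₛ)) span-0ₛ
    span-τ̄-monomial-sum {m = suc m} i W g span-g =
      span-cong (≈ₛ-sym τ̄-split) (span-+ₛ (span-g Fin.zero) (span-τ̄-monomial-sum i W (g ∘ Fin.suc) (span-g ∘ Fin.suc)))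
      where
      g₀ = monomial (g Fin.zero) i
      g₊ = monomial (sum (g ∘ Fin.suc)) i
      τ̄-split : τ̄ (monomial (sum g) i ⊛ W) ≈ₛ (τ̄ (g₀ ⊛ W) +ₛ τ̄ (g₊ ⊛ W))
      τ̄-split = begin
        τ̄ (monomial (sum g) i ⊛ W)   ≈⟨ τ̄-cong (⊛-congˡ W (monomial-+ _ _ i)) ⟩
        τ̄ ((g₀ +ₛ g₊) ⊛ W)           ≈⟨ τ̄-cong (⊛-comm _ W) ⟩
        τ̄ (W ⊛ (g₀ +ₛ g₊))           ≈⟨ τ̄-cong (⊛-distribˡ W g₀ g₊) ⟩
        τ̄ ((W ⊛ g₀) +ₛ (W ⊛ g₊))     ≈⟨ τ̄-cong (+ₛ-cong (⊛-comm W g₀) (⊛-comm W g₊)) ⟩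
        τ̄ ((g₀ ⊛ W) +ₛ (g₊ ⊛ W))     ≈⟨ τ̄-+ₛ _ _ ⟩
        τ̄ (g₀ ⊛ W) +ₛ τ̄ (g₊ ⊛ W)     ∎
        where open ≈ₛ-Reasoning

    frob-sum : ∀ {n} (g : Fin n → Carrier) → sum g ^ᴿ p ≈ sum (λ j → g j ^ᴿ p)
    frob-sum {zero}  g = frob-0
    frob-sum {suc n} g = trans (frob-+ _ _) (+-cong refl (frob-sum (g ∘ Fin.suc)))

    w̄-cong : ∀ d {b b′ : IFDatum d} → (∀ t → b t ≡ b′ t) → w̄ d b ≈ₛ w̄ d b′
    w̄-cong zero    b≡b′ = ≈ₛ-refl
    w̄-cong (suc d) b≡b′ = τ̄-cong (⊛-cong (≈ₛ-reflexive (≡.cong xSeries (b≡b′ (fromℕ d)))) (w̄-cong d (b≡b′ ∘ inject₁)))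

    module Coefficients (f : List (Fin p)) where

      L : ℕ
      L = length f

      coeff : ℕ → Carrier
      coeff a = fSeries f (suc a)

      fSeries-expansion : fSeries f ≈ₛ sumₛ L (λ a → monomial (coeff a) (suc a))
      fSeries-expansion zero    = sym (sumTo-zero L (λ a _ → monomial-≢ (coeff a) (suc a) 0 (λ ())))
      fSeries-expansion (suc n) with n ℕ.<? L
      ... | yes n<L = sym (trans (sumTo-single L n _ n<L (λ a _ a≢n → monomial-≢ _ (suc a) (suc n) (a≢n ∘ ≡.sym ∘ ℕ.suc-injective)))
                                 (monomial-same (coeff n) (suc n)))
      ... | no n≮L  = trans (coefFp-≥length f n (ℕ.≮⇒≥ n≮L))
                            (sym (sumTo-zero L (λ a a<L → monomial-≢ _ (suc a) (suc n) (λ n+1≡a+1 → n≮L (≡.subst (_< L) (ℕ.suc-injective (≡.sym n+1≡a+1)) a<L)))))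

      core : ℕ → ℕ
      core a = PowerSplit.cofactor (powerSplit (suc a))

      collapsed : Series
      collapsed = sumₛ L (λ a → monomial (coeff a) (core a))

      cstar-term : ℕ → Series
      cstar-term i with p ∣? suc i
      ... | yes _ = 0ₛ
      ... | no _  = monomial (cstar f (suc i)) (suc i)

      cstar-term-∤ : ∀ i → ¬ p ∣ suc i → cstar-term i ≈ₛ monomial (cstar f (suc i)) (suc i)
      cstar-term-∤ i p∤i+1 with p ∣? suc i
      ... | yes p∣i+1 = ⊥-elim (p∤i+1 p∣i+1)
      ... | no _      = ≈ₛ-refl

      cstar-term-≢ : ∀ i N → (¬ p ∣ suc i → N ≢ suc i) → cstar-term i N ≈ 0#
      cstar-term-≢ i N N≢i+1 with p ∣? suc i
      ... | yes _     = refl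
      ... | no p∤i+1  = monomial-≢ _ _ N (N≢i+1 p∤i+1)

      core-≤ : ∀ a → core a ℕ.≤ suc a
      core-≤ a = ≡.subst (cofactor ℕ.≤_) (≡.sym split) (ℕ.m≤m*n cofactor (p ℕ.^ exponent) ⦃ ℕ.m^n≢0 p exponent ⦄)
        where open PowerSplit (powerSplit (suc a))

      p∤core : ∀ a → ¬ p ∣ core a
      p∤core a = PowerSplit.p∤cofactor (powerSplit (suc a))

      collapsed-≈0 : ∀ N → (∀ a → a < L → core a ≢ N) → collapsed N ≈ 0#
      collapsed-≈0 N core≢N = sumTo-zero L (λ a a<L → monomial-≢ _ _ N (core≢N a a<L ∘ ≡.sym))

      cstar-terms-≈0 : ∀ N → (∀ i → i < L → ¬ p ∣ suc i → N ≢ suc i) → sumₛ L cstar-term N ≈ 0#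
      cstar-terms-≈0 N N≢ = sumTo-zero L (λ i i<L → cstar-term-≢ i N (N≢ i i<L))

      -- x^(a+1) = x^(i p^m₀) with p ∤ i meets x^(N p^m) with p ∤ N only for N = i and m = m₀.
      sumTo-monomial-powers : ∀ N a → ¬ p ∣ N → a < L →
        sumTo (suc L) (λ m → monomial (coeff a) (suc a) (N ℕ.* p ℕ.^ m)) ≈ monomial (coeff a) (core a) N
      sumTo-monomial-powers N a p∤N a<L with N ℕ.≟ cofactor
        where open PowerSplit (powerSplit (suc a))
      ... | yes ≡.refl = trans (sumTo-single (suc L) exponent _ exponent<L+1 others) (monomial-≡ _ _ _ (≡.sym split))
        where
        open PowerSplit (powerSplit (suc a))
        exponent<L+1 : exponent < suc L
        exponent<L+1 = s≤s (ℕ.<⇒≤ (ℕ.<-≤-trans (m<p^m exponent)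
                         (ℕ.≤-trans (ℕ.m≤n*m (p ℕ.^ exponent) cofactor ⦃ ℕ.>-nonZero (∤⇒>0 p∤cofactor) ⦄)
                           (≡.subst (ℕ._≤ L) split a<L))))
        others : ∀ m → m < suc L → m ≢ exponent → monomial (coeff a) (suc a) (N ℕ.* p ℕ.^ m) ≈ 0#
        others m _ m≢e = monomial-≢ _ _ _ (λ Np^m≡a+1 → m≢e (proj₂ (powerSplit-unique N m N exponent p∤N p∤N (≡.trans Np^m≡a+1 split))))
      -- Here the right-hand side has already reduced to 0#: monomial decides the same N ≟ cofactor.
      ... | no N≢i = trans (sumTo-zero (suc L) (λ m _ → monomial-≢ _ _ _ (λ Np^m≡a+1 →
                             N≢i (proj₁ (powerSplit-unique N m cofactor exponent p∤N p∤cofactor (≡.trans Np^m≡a+1 split))))))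
                           refl
        where open PowerSplit (powerSplit (suc a))

      collapsed≈cstar-terms : collapsed ≈ₛ sumₛ L cstar-term
      collapsed≈cstar-terms zero =
        trans (collapsed-≈0 0 (λ a _ core≡0 → p∤core a (≡.subst (p ∣_) (≡.sym core≡0) (p ∣0))))
              (sym (cstar-terms-≈0 0 (λ _ _ _ ())))
      collapsed≈cstar-terms (suc n) with p ∣? suc n
      ... | yes p∣n+1 =
        trans (collapsed-≈0 (suc n) (λ a _ core≡n+1 → p∤core a (≡.subst (p ∣_) (≡.sym core≡n+1) p∣n+1)))
              (sym (cstar-terms-≈0 (suc n) (λ i _ p∤i+1 n≡i → p∤i+1 (≡.subst (p ∣_) n≡i p∣n+1))))
      ... | no p∤n+1 with n ℕ.<? L
      ...   | no n≮L =
        trans (collapsed-≈0 (suc n) (λ a a<L core≡n+1 → n≮L (ℕ.<-≤-trans (≡.subst (ℕ._≤ suc a) core≡n+1 (core-≤ a)) a<L)))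
              (sym (cstar-terms-≈0 (suc n) (λ i i<L _ n≡i → n≮L (≡.subst (_< L) (≡.sym (ℕ.suc-injective n≡i)) i<L))))
      ...   | yes n<L = sym (begin
        sumₛ L cstar-term (suc n)
          ≈⟨ sumTo-single L n _ n<L (λ i _ i≢n → cstar-term-≢ i (suc n) (λ _ n≡i → i≢n (≡.sym (ℕ.suc-injective n≡i)))) ⟩
        cstar-term n (suc n)
          ≈⟨ cstar-term-∤ n p∤n+1 (suc n) ⟩
        monomial (cstar f (suc n)) (suc n) (suc n)
          ≈⟨ monomial-same (cstar f (suc n)) (suc n) ⟩
        sumTo (suc L) (λ m → fSeries f (suc n ℕ.* p ℕ.^ m))
          ≈⟨ sumTo-cong (suc L) (λ m → fSeries-expansion (suc n ℕ.* p ℕ.^ m)) ⟩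
        sumTo (suc L) (λ m → sumTo L (λ a → monomial (coeff a) (suc a) (suc n ℕ.* p ℕ.^ m)))
          ≈⟨ sumTo-swap (suc L) L _ ⟩
        sumTo L (λ a → sumTo (suc L) (λ m → monomial (coeff a) (suc a) (suc n ℕ.* p ℕ.^ m)))
          ≈⟨ sumTo-cong< L (λ a a<L → sumTo-monomial-powers (suc n) a p∤n+1 a<L) ⟩
        collapsed (suc n) ∎)
        where open ≈-Reasoning

    module _ (NB : NormalBasis) where
      open NormalBasis NB
      open WithBasis NB

      mutual
        combine≈sumTo-restrict : ∀ a → combine a ≈ sumTo e (restrict (λ j → ι (a j) * ζpow j))
        combine≈sumTo-restrict a = sumTo-cong e (summand≈restrict a)

        -- The left-hand side is the summand of combine, a local function of Defs that cannot be named.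
        summand≈restrict : ∀ a n → _
        summand≈restrict a n with n ℕ.<? e
        ... | yes _ = refl
        ... | no _  = refl

      coord-expansion : ∀ y → y ≈ sum (λ j → ι (coord y j) * ζpow j)
      coord-expansion y = trans (sym (combine-coord y)) (trans (combine≈sumTo-restrict (coord y)) (sumTo-restrict e _))

      -- ζ^(p^(j-1)) is a p-th root of ζ^(p^j), so the coordinates (fixed by Frobenius) give p-th roots.
      root : Carrier → Carrier
      root y = sum (λ j → ι (coord y j) * ζ ^ᴿ (p ℕ.^ toℕ j))

      root^p : ∀ y → root y ^ᴿ p ≈ y
      root^p y = trans (frob-sum (λ j → ι (coord y j) * ζ ^ᴿ (p ℕ.^ toℕ j))) (trans (sum-cong-≋ {e} (λ j → trans (frob-* _ _) (*-cong (frob-ι (coord y j)) (ζ-root j))))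
                                          (sym (coord-expansion y)))
        where
        ζ-root : ∀ j → (ζ ^ᴿ (p ℕ.^ toℕ j)) ^ᴿ p ≈ ζpow j
        ζ-root j = trans (sym (^ᴿ-* ζ (p ℕ.^ toℕ j) p)) (reflexive (≡.cong (ζ ^ᴿ_) (ℕ.*-comm (p ℕ.^ toℕ j) p)))

      root^ : ℕ → Carrier → Carrier
      root^ zero    y = y
      root^ (suc m) y = root (root^ m y)

      frob^-root^ : ∀ m y → frob^ m (root^ m y) ≈ y
      frob^-root^ zero    y = *-identityʳ y
      frob^-root^ (suc m) y = trans (frob^-suc m _) (trans (^ᴿ-cong (p ℕ.^ m) (root^p _)) (frob^-root^ m y))

      snoc-last : ∀ k (b : IFDatum k) z → snoc b z (fromℕ k) ≡ z
      snoc-last zero    b z = ≡.refl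
      snoc-last (suc k) b z = snoc-last k (b ∘ Fin.suc) z

      snoc-inject₁ : ∀ k (b : IFDatum k) z t → snoc b z (inject₁ t) ≡ b t
      snoc-inject₁ (suc k) b z Fin.zero    = ≡.refl
      snoc-inject₁ (suc k) b z (Fin.suc t) = snoc-inject₁ k (b ∘ Fin.suc) z t

      w̄-snoc : ∀ d (b : IFDatum d) z → w̄ (suc d) (snoc b z) ≈ₛ τ̄ (xSeries z ⊛ w̄ d b)
      w̄-snoc d b z = τ̄-cong (⊛-cong (≈ₛ-reflexive (≡.cong xSeries (snoc-last d b z))) (w̄-cong d (snoc-inject₁ d b z)))

      -- For p ∤ i, expanding c in the normal basis writes τ̄ (c x^i w̄ b) as a combination of the w̄ (snoc b x_j^i).
      span-τ̄-monomial-⊛-w̄ : ∀ {n} c i → ¬ p ∣ i → ∀ d (b : IFDatum d) → d < n → Span (suc n) (τ̄ (monomial c i ⊛ w̄ d b))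
      span-τ̄-monomial-⊛-w̄ {n} c i p∤i d b d<n =
        span-cong (τ̄-cong (⊛-congˡ (w̄ d b) (monomial-cong i (sym (coord-expansion c)))))
                  (span-τ̄-monomial-sum i (w̄ d b) _ letter)
        where
        letter : ∀ j → Span (suc n) (τ̄ (monomial (ι (coord c j) * ζpow j) i ⊛ w̄ d b))
        letter j = span-cong (≈ₛ-sym τ̄-letter) (span-·ₛ (ι (coord c j)) (span-cong (⊛-identityˡ W′)
                     (span-cong (⊛-congˡ W′ (≈ₛ-sym 1ₛ≈monomial)) (span-term 1# 0 (suc d) (snoc b z) (s≤s d<n)))))
          where
          z = mkX i j (∤⇒>0 p∤i) p∤i
          W′ = w̄ (suc d) (snoc b z)
          τ̄-letter : τ̄ (monomial (ι (coord c j) * ζpow j) i ⊛ w̄ d b) ≈ₛ (ι (coord c j) ·ₛ w̄ (suc d) (snoc b z))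
          τ̄-letter = begin
            τ̄ (monomial (ι (coord c j) * ζpow j) i ⊛ w̄ d b)   ≈⟨ τ̄-cong (⊛-congˡ (w̄ d b) (monomial-* _ _ i)) ⟩
            τ̄ ((ι (coord c j) ·ₛ xSeries z) ⊛ w̄ d b)          ≈⟨ τ̄-cong (·ₛ-⊛ _ (xSeries z) (w̄ d b)) ⟩
            τ̄ (ι (coord c j) ·ₛ (xSeries z ⊛ w̄ d b))          ≈⟨ τ̄-·ₛ _ (frob-ι (coord c j)) ⟩
            ι (coord c j) ·ₛ τ̄ (xSeries z ⊛ w̄ d b)            ≈⟨ ·ₛ-congʳ _ (w̄-snoc d b z) ⟨
            ι (coord c j) ·ₛ w̄ (suc d) (snoc b z)             ∎
            where open ≈ₛ-Reasoning

      mutual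
        τ̄-x̂⊛-span : ∀ n {T} → Span n T → Span (suc n) (τ̄ (x̂ ⊛ T))
        τ̄-x̂⊛-span n (ts , T≈ts) = span-cong (τ̄-cong (⊛-congʳ x̂ (≈ₛ-sym T≈ts))) (over-terms ts)
          where
          over-terms : ∀ (ts : List (Term n)) → Span (suc n) (τ̄ (x̂ ⊛ ⟦ ts ⟧))
          over-terms [] = span-cong (≈ₛ-sym (≈ₛ-trans (τ̄-cong (⊛-zeroʳ x̂)) τ̄-0ₛ)) span-0ₛ
          over-terms (term a k d d<n b ∷ ts) =
            span-cong (≈ₛ-sym (≈ₛ-trans (τ̄-cong (⊛-distribˡ x̂ (monomial a k ⊛ w̄ d b) ⟦ ts ⟧)) (τ̄-+ₛ _ _)))
                      (span-+ₛ (τ̄-x̂⊛-term a k d b d<n) (over-terms ts))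

        -- Write x^(k+1) = x^(i p^m) with p ∤ i, reduce the exponent to i, then add a letter x_j^i.
        τ̄-x̂⊛-term : ∀ {n} a k d (b : IFDatum d) → d < n → Span (suc n) (τ̄ (x̂ ⊛ (monomial a k ⊛ w̄ d b)))
        τ̄-x̂⊛-term {suc n} a k d b (s≤s d≤n) =
          let open PowerSplit (powerSplit (suc k))
              c = root^ exponent a
              D , span-D , τ̄≈ = τ̄-reduce-exponent (τ̄-x̂⊛-span n) cofactor exponent d b d≤n (frob^-root^ exponent a) (∤⇒>0 p∤cofactor)
              x̂⊛≈ = ≈ₛ-trans (x̂-⊛-monomial-⊛ a k (w̄ d b)) (⊛-congˡ (w̄ d b) (≈ₛ-reflexive (≡.cong (monomial a) split)))
          in span-cong (≈ₛ-sym (≈ₛ-trans (τ̄-cong x̂⊛≈) τ̄≈))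
                       (span-+ₛ (span-τ̄-monomial-⊛-w̄ c cofactor p∤cofactor d b (s≤s d≤n)) (span-≤ (ℕ.n≤1+n _) span-D))

      sumSeries-cong : ∀ {A : Set} {F G : A → Series} xs → (∀ x → F x ≈ₛ G x) → sumSeries (List.map F xs) ≈ₛ sumSeries (List.map G xs)
      sumSeries-cong []       F≈G = ≈ₛ-refl
      sumSeries-cong (x ∷ xs) F≈G = +ₛ-cong (F≈G x) (sumSeries-cong xs F≈G)

      sumSeries-++ : ∀ xs ys → sumSeries (xs ++ ys) ≈ₛ (sumSeries xs +ₛ sumSeries ys)
      sumSeries-++ []       ys N = sym (+-identityˡ _)
      sumSeries-++ (x ∷ xs) ys N = trans (+-cong refl (sumSeries-++ xs ys N)) (sym (+-assoc _ _ _))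

      sumSeries-concatMap : ∀ {A B : Set} (F : B → Series) (g : A → List B) xs →
        sumSeries (List.map F (List.concatMap g xs)) ≈ₛ sumSeries (List.map (λ x → sumSeries (List.map F (g x))) xs)
      sumSeries-concatMap F g []       = ≈ₛ-refl
      sumSeries-concatMap F g (x ∷ xs) =
        ≈ₛ-trans (≈ₛ-reflexive (≡.cong sumSeries (Listₚ.map-++ F (g x) (List.concatMap g xs))))
                 (≈ₛ-trans (sumSeries-++ (List.map F (g x)) _) (+ₛ-cong ≈ₛ-refl (sumSeries-concatMap F g xs)))

      sumSeries-applyUpTo : ∀ (G : ℕ → Series) f n → sumSeries (List.map G (List.applyUpTo f n)) ≈ₛ sumₛ n (G ∘ f)
      sumSeries-applyUpTo G f zero    = ≈ₛ-refl
      sumSeries-applyUpTo G f (suc n) = ≈ₛ-trans (+ₛ-cong ≈ₛ-refl (sumSeries-applyUpTo G (f ∘ suc) n)) (λ N → sym (sumTo-head n _))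

      sumSeries-allFin : ∀ n (h : Fin n → Series) → sumSeries (List.map h (List.allFin n)) ≈ₛ (λ N → sum (λ j → h j N))
      sumSeries-allFin n h = ≈ₛ-trans (≈ₛ-reflexive (≡.cong sumSeries (Listₚ.map-tabulate id h))) (sumSeries-tabulate n h)
        where
        sumSeries-tabulate : ∀ n (h : Fin n → Series) → sumSeries (List.tabulate h) ≈ₛ (λ N → sum (λ j → h j N))
        sumSeries-tabulate zero    h = ≈ₛ-refl
        sumSeries-tabulate (suc n) h = +ₛ-cong ≈ₛ-refl (sumSeries-tabulate n (h ∘ Fin.suc))

      ·ₛ-sumSeries : ∀ {A : Set} a (F : A → Series) xs → (a ·ₛ sumSeries (List.map F xs)) ≈ₛ sumSeries (List.map (λ x → a ·ₛ F x) xs)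
      ·ₛ-sumSeries a F []       N = zeroʳ a
      ·ₛ-sumSeries a F (x ∷ xs)   = ≈ₛ-trans (·ₛ-+ₛ a (F x) _) (+ₛ-cong ≈ₛ-refl (·ₛ-sumSeries a F xs))

      ≅-sumSeries : ∀ {A : Set} {n} {F G : A → Series} xs → (∀ x → F x ≅ G x [mod n ]) →
        sumSeries (List.map F xs) ≅ sumSeries (List.map G xs) [mod n ]
      ≅-sumSeries []       F≅G = ≈⇒≅ ≈ₛ-refl
      ≅-sumSeries (x ∷ xs) F≅G = ≅-+ₛ (F≅G x) (≅-sumSeries xs F≅G)

      τ̄-⊛-sumSeries : ∀ {A : Set} S (a : A → Carrier) (W : A → Series) xs → (∀ x → a x ^ᴿ p ≈ a x) →
        τ̄ (S ⊛ sumSeries (List.map (λ x → a x ·ₛ W x) xs)) ≈ₛ sumSeries (List.map (λ x → a x ·ₛ τ̄ (S ⊛ W x)) xs)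
      τ̄-⊛-sumSeries S a W []       a-fixed = ≈ₛ-trans (τ̄-cong (⊛-zeroʳ S)) τ̄-0ₛ
      τ̄-⊛-sumSeries S a W (x ∷ xs) a-fixed = begin
        τ̄ (S ⊛ ((a x ·ₛ W x) +ₛ rest))              ≈⟨ τ̄-cong (⊛-distribˡ S (a x ·ₛ W x) rest) ⟩
        τ̄ ((S ⊛ (a x ·ₛ W x)) +ₛ (S ⊛ rest))        ≈⟨ τ̄-+ₛ _ _ ⟩
        τ̄ (S ⊛ (a x ·ₛ W x)) +ₛ τ̄ (S ⊛ rest)        ≈⟨ +ₛ-cong (≈ₛ-trans (τ̄-cong (⊛-·ₛ (a x) S (W x))) (τ̄-·ₛ _ (a-fixed x)))
                                                              (τ̄-⊛-sumSeries S a W xs a-fixed) ⟩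
        (a x ·ₛ τ̄ (S ⊛ W x)) +ₛ sumSeries (List.map (λ x → a x ·ₛ τ̄ (S ⊛ W x)) xs) ∎
        where
        open ≈ₛ-Reasoning
        rest = sumSeries (List.map (λ x → a x ·ₛ W x) xs)

      module _ (f : List (Fin p)) where
        open Coefficients f

        letters : Series
        letters = sumSeries (List.map (λ z → ι (cstarX f z) ·ₛ xSeries z) (Xupto L))

        mutual
          letters≈cstar-terms : letters ≈ₛ sumₛ L cstar-term
          letters≈cstar-terms = ≈ₛ-trans (sumSeries-concatMap (λ z → ι (cstarX f z) ·ₛ xSeries z) _ (List.upTo L))
            (≈ₛ-trans (sumSeries-cong (List.upTo L) row≈cstar-term) (sumSeries-applyUpTo cstar-term id L))

          -- The left-hand side is the sum over a row of Xupto, a local function of Defs that cannot be named.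
          row≈cstar-term : ∀ i → _
          row≈cstar-term i with p ∣? suc i
          ... | yes _ = ≈ₛ-refl
          ... | no _  = ≈ₛ-trans (≈ₛ-reflexive (≡.cong sumSeries (≡.sym (Listₚ.map-∘ (List.allFin e)))))
                          (≈ₛ-trans (sumSeries-allFin e _)
                            (≈ₛ-trans (sum-monomial (λ j → ι (coord (cstar f (suc i)) j)) ζpow (suc i))
                              (monomial-cong (suc i) (sym (coord-expansion (cstar f (suc i)))))))

        τ̄-f⊛-w̄ : ∀ d (b : IFDatum d) →
          τ̄ (fSeries f ⊛ w̄ d b) ≅ sumSeries (List.map (λ z → ι (cstarX f z) ·ₛ w̄ (suc d) (snoc b z)) (Xupto L)) [mod suc d ]
        τ̄-f⊛-w̄ d b = ≅-trans (≈⇒≅ expand) (≅-trans (≅-sumₛ L reduce) (≈⇒≅ collect))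
          where
          W = w̄ d b
          expand : τ̄ (fSeries f ⊛ W) ≈ₛ sumₛ L (λ a → τ̄ (monomial (coeff a) (suc a) ⊛ W))
          expand = ≈ₛ-trans (τ̄-cong (≈ₛ-trans (⊛-congˡ W fSeries-expansion) (sumₛ-⊛ L W _))) (τ̄-sumₛ L _)
          reduce : ∀ a → τ̄ (monomial (coeff a) (suc a) ⊛ W) ≅ τ̄ (monomial (coeff a) (core a) ⊛ W) [mod suc d ]
          reduce a = ≅-trans (≈⇒≅ (τ̄-cong (⊛-congˡ W (≈ₛ-reflexive (≡.cong (monomial (coeff a)) split)))))
                             (τ̄-reduce-exponent (τ̄-x̂⊛-span d) cofactor exponent d b ℕ.≤-refl
                               (frob^-fixed exponent (coeff a) (frob-coefFp f a)) (∤⇒>0 p∤cofactor))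
            where open PowerSplit (powerSplit (suc a))
          collect : sumₛ L (λ a → τ̄ (monomial (coeff a) (core a) ⊛ W))
                    ≈ₛ sumSeries (List.map (λ z → ι (cstarX f z) ·ₛ w̄ (suc d) (snoc b z)) (Xupto L))
          collect = begin
            sumₛ L (λ a → τ̄ (monomial (coeff a) (core a) ⊛ W))              ≈⟨ ≈ₛ-trans (τ̄-cong (sumₛ-⊛ L W _)) (τ̄-sumₛ L _) ⟨
            τ̄ (collapsed ⊛ W)                                               ≈⟨ τ̄-cong (⊛-congˡ W (≈ₛ-trans collapsed≈cstar-terms (≈ₛ-sym letters≈cstar-terms))) ⟩
            τ̄ (letters ⊛ W)                                                 ≈⟨ τ̄-cong (⊛-comm letters W) ⟩
            τ̄ (W ⊛ letters)                                                 ≈⟨ τ̄-⊛-sumSeries W (λ z → ι (cstarX f z)) xSeries (Xupto L) (λ z → frob-ι (cstarX f z)) ⟩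
            sumSeries (List.map (λ z → ι (cstarX f z) ·ₛ τ̄ (W ⊛ xSeries z)) (Xupto L))
              ≈⟨ sumSeries-cong (Xupto L) (λ z → ·ₛ-congʳ _ (≈ₛ-trans (τ̄-cong (⊛-comm W (xSeries z))) (≈ₛ-sym (w̄-snoc d b z)))) ⟩
            sumSeries (List.map (λ z → ι (cstarX f z) ·ₛ w̄ (suc d) (snoc b z)) (Xupto L)) ∎
            where open ≈ₛ-Reasoning

        f/x : Series
        f/x = sumₛ L (λ a → monomial (coeff a) a)

        fSeries≈x̂⊛f/x : fSeries f ≈ₛ (x̂ ⊛ f/x)
        fSeries≈x̂⊛f/x = ≈ₛ-trans fSeries-expansion (≈ₛ-sym (≈ₛ-trans (⊛-sumₛ L x̂ (λ a → monomial (coeff a) a))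
                        (sumₛ-cong L (λ a → ≈ₛ-trans (monomial-⊛-monomial 1# 1 (coeff a) a) (monomial-cong (suc a) (*-identityˡ _))))))

        τ̄-f⊛-span : ∀ {k R} → Span k R → Span (suc k) (τ̄ (fSeries f ⊛ R))
        τ̄-f⊛-span {k} {R} span-R =
          span-cong (τ̄-cong (≈ₛ-trans (≈ₛ-sym (⊛-assoc x̂ f/x R)) (⊛-congˡ R (≈ₛ-sym fSeries≈x̂⊛f/x))))
                    (τ̄-x̂⊛-span k (span-cong (≈ₛ-sym (sumₛ-⊛ L R (λ a → monomial (coeff a) a)))
                                              (span-sumₛ L (λ a _ → span-monomial-⊛ (coeff a) a span-R))))

        frob-cstarB : ∀ k b → cstarB f k b ^ᴿ p ≈ cstarB f k b
        frob-cstarB k b = frob-prodFin k _ (λ t → frob-ι (cstarX f (b t)))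
          where
          frob-prodFin : ∀ k (g : Fin k → Carrier) → (∀ t → g t ^ᴿ p ≈ g t) → prodFin k g ^ᴿ p ≈ prodFin k g
          frob-prodFin zero    g g-fixed = frob-1
          frob-prodFin (suc k) g g-fixed = trans (frob-* _ _) (*-cong (g-fixed Fin.zero) (frob-prodFin k (g ∘ Fin.suc) (g-fixed ∘ Fin.suc)))

        extensions : ∀ k → IFDatum k → Series
        extensions k b = sumSeries (List.map (λ z → ι (cstarX f z) ·ₛ w̄ (suc k) (snoc b z)) (Xupto L))

        mainSum-suc : ∀ k → mainSum f (suc k) ≈ₛ sumSeries (List.map (λ b → cstarB f k b ·ₛ extensions k b) (dataUpto L k))
        mainSum-suc k = ≈ₛ-trans (sumSeries-concatMap (λ b′ → cstarB f (suc k) b′ ·ₛ w̄ (suc k) b′) (λ b → List.map (snoc b) (Xupto L)) (dataUpto L k))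
          (sumSeries-cong (dataUpto L k) (λ b → ≈ₛ-trans (≈ₛ-reflexive (≡.cong sumSeries (≡.sym (Listₚ.map-∘ (Xupto L)))))
            (≈ₛ-trans (sumSeries-cong (Xupto L) (λ z → ≈ₛ-trans (·ₛ-cong (cstarB-snoc b z) ≈ₛ-refl) (≈ₛ-sym (·ₛ-·ₛ _ _ _))))
              (≈ₛ-sym (·ₛ-sumSeries (cstarB f k b) _ (Xupto L))))))
          where
          prodFin-snoc : ∀ k (h : Xel → Carrier) (b : IFDatum k) z → prodFin (suc k) (h ∘ snoc b z) ≈ prodFin k (h ∘ b) * h z
          prodFin-snoc zero    h b z = trans (*-identityʳ _) (sym (*-identityˡ _))
          prodFin-snoc (suc k) h b z = trans (*-cong refl (prodFin-snoc k h (b ∘ Fin.suc) z)) (sym (*-assoc _ _ _))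
          cstarB-snoc : ∀ b z → cstarB f (suc k) (snoc b z) ≈ cstarB f k b * ι (cstarX f z)
          cstarB-snoc = prodFin-snoc k (λ z → ι (cstarX f z))

        ω̄∘f≅mainSum : ∀ k → subst (ω̄ k) (fSeries f) ≅ mainSum f k [mod k ]
        ω̄∘f≅mainSum zero = ≈⇒≅ (λ N → trans (subst-1ₛ (fSeries f) N) (sym (trans (+-identityʳ _) (*-identityˡ _))))
        ω̄∘f≅mainSum (suc k) with ω̄∘f≅mainSum k
        ... | R , span-R , Ω≈ = ≅-trans (≈⇒≅ Ω-suc≈) (≅-trans (≅-+ₛ main (span⇒≅0ₛ (τ̄-f⊛-span span-R))) (≈⇒≅ (λ N → +-identityʳ _)))
          where
          bs = dataUpto L k
          Ω-suc≈ : subst (ω̄ (suc k)) (fSeries f) ≈ₛ (τ̄ (fSeries f ⊛ mainSum f k) +ₛ τ̄ (fSeries f ⊛ R))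
          Ω-suc≈ = ≈ₛ-trans (ω̄∘f-suc f k) (≈ₛ-trans (τ̄-cong (≈ₛ-trans (⊛-congʳ (fSeries f) Ω≈) (⊛-distribˡ (fSeries f) (mainSum f k) R))) (τ̄-+ₛ _ _))
          main : τ̄ (fSeries f ⊛ mainSum f k) ≅ mainSum f (suc k) [mod suc k ]
          main = ≅-trans (≈⇒≅ (τ̄-⊛-sumSeries (fSeries f) (cstarB f k) (w̄ k) bs (frob-cstarB k)))
                   (≅-trans (≅-sumSeries bs (λ b → ≅-·ₛ (cstarB f k b) (τ̄-f⊛-w̄ k b))) (≈⇒≅ (≈ₛ-sym (mainSum-suc k))))

lemma4p9 : ∀ {c ℓ} (F : CommutativeRing c ℓ) → IsField F →
    (p e : ℕ) → Prime p → (ζ : CommutativeRing.Carrier F) →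
    Setup.HasChar F p e ζ →
    (NB : Setup.NormalBasis F p e ζ) →
    (f : List (Fin p)) → (k : ℕ) → 1 ≤ k →
    Setup.InM̄ F p e ζ (pred k)
      (Setup._-ₛ_ F p e ζ
        (Setup.subst F p e ζ (Setup.ω̄ F p e ζ k) (Setup.fSeries F p e ζ f))
        (Setup.WithBasis.mainSum F p e ζ NB f k))
lemma4p9 F F-field p e pr ζ char NB f (suc k) _ =
  span⇒InM̄ (IsField.1≉0 F-field) (≅⇒span-difference (ω̄∘f≅mainSum pr char NB f (suc k)))
  where open SeriesOver F p e ζ
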